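{- Let $n\geq 2$, let $\alpha=(\alpha_1,\dots,\alpha_\ell)$ be a composition of $n$, and let $b_\alpha(q)$ be the coefficient of $M_\alpha$ in $T\mathrm{st}_n(q)$. For $0\le k\leq\lfloor\frac{n-1}{2}\rfloor$, $$[q^k]\,b_\alpha(q)=\sum_{i:\ \alpha_i=1}\mathrm{mult}(\mathrm{rcomp}(\alpha,i))\,\mathrm{mult}(\mathrm{lcomp}(\alpha,i))\sum_{j=0}^{s_0}\binom{s+k-2j}{s-j}\binom{n-1-s-k+2j}{j},$$ where in each summand $s=\min\{R_{\alpha_i},L_{\alpha_i}\}$ and $s_0=\min\{s,k\}$. Equivalently, for each $i$ with $\alpha_i=1$, $$[q^k]\,b_\alpha(i;q)=\mathrm{mult}(\mathrm{rcomp}(\alpha,i))\,\mathrm{mult}(\mathrm{lcomp}(\alpha,i))\sum_{j=0}^{s_0}\binom{s+k-2j}{s-j}\binom{n-1-s-k+2j}{j}.$$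
   Context: The star graph $\mathrm{St}_n$ has $n$ vertices, a root $v_0$, and edges exactly $\{v_0,v\}$ for $v\ne v_0$. A labeling is a bijection $L:V\to\{1,\dots,n\}$; a proper coloring is $\kappa:V\to\mathbb{Z}_{>0}$ with adjacent vertices colored differently; $\mathrm{asc}^L(\kappa)$ counts edges $\{u,v\}$ with $L(u)<L(v)$ and $\kappa(u)<\kappa(v)$; $\chi^L_G(x;q)=\sum_\kappa q^{\mathrm{asc}^L(\kappa)}x^\kappa$ with $x^\kappa=\prod_j x_j^{\#\kappa^{ -1}(j)}$. For $1\le r\le n$, $\mathrm{st}^r_n(q)=\chi^L_{\mathrm{St}_n}(x;q)$ for any labeling with $L(v_0)=r$ (independent of the choice), and $T\mathrm{st}_n(q)=\sum_{r=1}^n\mathrm{st}^r_n(q)$. $M_\alpha=\sum_{i_1<\dots<i_\ell}x_{i_1}^{\alpha_1}\cdots x_{i_\ell}^{\alpha_\ell}$. For $i$ with $\alpha_i=1$, $b_\alpha(i;q)=\sum_{r=1}^n\sum_\kappa q^{\mathrm{asc}^L(\kappa)}$, where for each $r$, $L$ is a labeling with $L(v_0)=r$, and $\kappa$ runs over proper colorings $V\to\{1,\dots,\ell\}$ with $\#\kappa^{ -1}(j)=\alpha_j$ for all $j$ and $\kappa(v_0)=i$; so $b_\alpha(q)=\sum_{i:\alpha_i=1}b_\alpha(i;q)$. Notation: $\mathrm{lcomp}(\alpha,i)=(\alpha_1,\dots,\alpha_{i-1})$, $\mathrm{rcomp}(\alpha,i)=(\alpha_{i+1},\dots,\alpha_\ell)$,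 $L_{\alpha_i}=\alpha_1+\dots+\alpha_{i-1}$, $R_{\alpha_i}=\alpha_{i+1}+\dots+\alpha_\ell$, $\mathrm{mult}(\beta)=\frac{|\beta|!}{\prod_m\beta_m!}$ with $\mathrm{mult}(\emptyset)=1$. -}

module Defs where

open import Data.Nat using (ℕ; zero; suc; _+_; _*_; _∸_; _<_; _≤_; _!; _/_; _⊓_; NonZero)
open import Data.Nat.Properties using (_!≢0; m*n≢0; _<?_; _≟_)
open import Data.Nat.Combinatorics using (_C_)
open import Data.Fin using (Fin; zero; suc; toℕ)
open import Data.Fin.Permutation using (Permutation′; _⟨$⟩ʳ_)
open import Data.List using (List; []; _∷_; length; map; filter; take; drop; lookup; allFin; concatMap; upTo)
open import Data.Nat.ListAction using (sum)
open import Data.Product using (_×_; _,_)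
open import Data.Sum using (_⊎_)
open import Relation.Nullary using (¬_; Dec; yes; no)
open import Relation.Nullary.Decidable using (_×-dec_; _⊎-dec_; ¬?)
open import Relation.Binary.PropositionalEquality using (_≡_)
import Data.Fin.Properties as FP

ΣFin : (n : ℕ) → (Fin n → ℕ) → ℕ
ΣFin n f = sum (map f (allFin n))

countFin : (n : ℕ) → {P : Fin n → Set} → ((x : Fin n) → Dec (P x)) → ℕ
countFin n P? = length (filter P? (allFin n))

allFuns : (n m : ℕ) → List (Fin n → Fin m)
allFuns zero    m = (λ ()) ∷ []
allFuns (suc n) m =
  concatMap (λ c → map (λ f → λ { zero → c ; (suc x) → f x }) (allFuns n m)) (allFin m)

countFuns : (n m : ℕ) → {P : (Fin n → Fin m) → Set} → ((f : Fin n → Fin m) → Dec (P f)) → ℕ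
countFuns n m P? = length (filter P? (allFuns n m))

data AllPos : List ℕ → Set where
  []  : AllPos []
  _∷_ : ∀ {a as} → 0 < a → AllPos as → AllPos (a ∷ as)

IsComposition : ℕ → List ℕ → Set
IsComposition n α = AllPos α × sum α ≡ n

prodFact : List ℕ → ℕ
prodFact []      = 1
prodFact (b ∷ β) = b ! * prodFact β

prodFact-nz : (β : List ℕ) → NonZero (prodFact β)
prodFact-nz []      = _
prodFact-nz (b ∷ β) = m*n≢0 (b !) (prodFact β) {{b !≢0}} {{prodFact-nz β}}

mult : List ℕ → ℕ
mult β = _/_ ((sum β) !) (prodFact β) {{prodFact-nz β}}

lcomp : (α : List ℕ) → Fin (length α) → List ℕ
lcomp α i = take (toℕ i) α

rcomp : (α : List ℕ) → Fin (length α) → List ℕ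
rcomp α i = drop (suc (toℕ i)) α

-- Star graph St_n on vertex set Fin n (n = suc m), root v0 = zero,
-- edges {zero, suc v} for v : Fin m.
-- A labeling is a bijection Fin n → Fin n (label j+1 represented by j : Fin n).
-- Colorings with colors in {1,..,ℓ} are represented by Fin n → Fin ℓ.

IsAscent : ∀ {m ℓ} → Permutation′ (suc m) → (Fin (suc m) → Fin ℓ) → Fin m → Set
IsAscent L κ v =
  (toℕ (L ⟨$⟩ʳ zero) < toℕ (L ⟨$⟩ʳ suc v) × toℕ (κ zero) < toℕ (κ (suc v)))
  ⊎ (toℕ (L ⟨$⟩ʳ suc v) < toℕ (L ⟨$⟩ʳ zero) × toℕ (κ (suc v)) < toℕ (κ zero))

isAscent? : ∀ {m ℓ} (L : Permutation′ (suc m)) (κ : Fin (suc m) → Fin ℓ) (v : Fin m) → Dec (IsAscent L κ v)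
isAscent? L κ v =
  ((toℕ (L ⟨$⟩ʳ zero) <? toℕ (L ⟨$⟩ʳ suc v)) ×-dec (toℕ (κ zero) <? toℕ (κ (suc v))))
  ⊎-dec ((toℕ (L ⟨$⟩ʳ suc v) <? toℕ (L ⟨$⟩ʳ zero)) ×-dec (toℕ (κ (suc v)) <? toℕ (κ zero)))

asc : ∀ {m ℓ} → Permutation′ (suc m) → (Fin (suc m) → Fin ℓ) → ℕ
asc {m} L κ = countFin m (isAscent? L κ)

colorCount : ∀ {n ℓ} → (Fin n → Fin ℓ) → Fin ℓ → ℕ
colorCount {n} κ j = countFin n (λ v → κ v FP.≟ j)

IsProperStar : ∀ {m ℓ} → (Fin (suc m) → Fin ℓ) → Set
IsProperStar {m} κ = (v : Fin m) → ¬ (κ (suc v) ≡ κ zero)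

HasContent : (α : List ℕ) → ∀ {n} → (Fin n → Fin (length α)) → Set
HasContent α κ = (j : Fin (length α)) → colorCount κ j ≡ lookup α j

Counted : ∀ {m} (α : List ℕ) → Fin (length α) → Permutation′ (suc m) → ℕ
        → (Fin (suc m) → Fin (length α)) → Set
Counted α i L k κ = IsProperStar κ × HasContent α κ × κ zero ≡ i × asc L κ ≡ k

private
  all? : ∀ {m} {P : Fin m → Set} → ((v : Fin m) → Dec (P v)) → Dec ((v : Fin m) → P v)
  all? = FP.all?

counted? : ∀ {m} (α : List ℕ) (i : Fin (length α)) (L : Permutation′ (suc m)) (k : ℕ)
           (κ : Fin (suc m) → Fin (length α)) → Dec (Counted α i L k κ)
counted? α i L k κ =
  all? (λ v → ¬? (κ (suc v) FP.≟ κ zero))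
  ×-dec (FP.all? (λ j → colorCount κ j ≟ lookup α j))
  ×-dec (κ zero FP.≟ i)
  ×-dec (asc L κ ≟ k)

RootLabeled : ∀ {m} → (Fin (suc m) → Permutation′ (suc m)) → Set
RootLabeled {m} Ls = (r : Fin (suc m)) → Ls r ⟨$⟩ʳ zero ≡ r

bCoeffAt : ∀ {m} → (Fin (suc m) → Permutation′ (suc m)) → (α : List ℕ) → Fin (length α) → ℕ → ℕ
bCoeffAt {m} Ls α i k =
  ΣFin (suc m) (λ r → countFuns (suc m) (length α) (counted? α i (Ls r) k))

bCoeff : ∀ {m} → (Fin (suc m) → Permutation′ (suc m)) → (α : List ℕ) → ℕ → ℕ
bCoeff Ls α k = ΣFin (length α) (λ i → onePart i)
  where
    onePart : Fin (length α) → ℕ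
    onePart i with lookup α i ≟ 1
    ... | yes _ = bCoeffAt Ls α i k
    ... | no  _ = 0

Lsum Rsum : (α : List ℕ) → Fin (length α) → ℕ
Lsum α i = sum (lcomp α i)
Rsum α i = sum (rcomp α i)

-- Σ_{j=0}^{s0} C(s+k-2j, s-j) C(n-1-s-k+2j, j), s0 = min s k
-- (s+k-2j written (s ∸ j) + (k ∸ j); n-1-s-k+2j written (n ∸ 1 ∸ s ∸ k) + 2j,
--  both exact since j ≤ min s k and s + k ≤ n - 1 in the theorem's range)
innerSum : (n s k : ℕ) → ℕ
innerSum n s k = sum (map term (upTo (suc (s ⊓ k))))
  where
    term : ℕ → ℕ
    term j = (((s ∸ j) + (k ∸ j)) C (s ∸ j)) * (((((n ∸ 1) ∸ s) ∸ k) + 2 * j) C j)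

rhsAt : ℕ → (α : List ℕ) → Fin (length α) → ℕ → ℕ
rhsAt n α i k =
  mult (rcomp α i) * mult (lcomp α i) * innerSum n (Rsum α i ⊓ Lsum α i) k

rhs : ℕ → (α : List ℕ) → ℕ → ℕ
rhs n α k = ΣFin (length α) onePart
  where
    onePart : Fin (length α) → ℕ
    onePart i with lookup α i ≟ 1
    ... | yes _ = rhsAt n α i k
    ... | no  _ = 0

{-# OPTIONS --safe #-}
-- Fix the root color i (so α_i = 1) and a labeling in which the root has label r ∈ {0, …, m}.
-- The edge to a leaf is an ascent iff the leaf is labeled above the root and colored above i, or
-- labeled below the root and colored below i. So a coloring of the m leaves with content α − e_i
-- amounts to choosing which leaves receive one of the R = R_{α_i} high colors, together with an
-- arrangement of the high colors and one of the low colors, counted by mult(rcomp α i) · mult(lcomp α i).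
-- Exactly r leaves are labeled below the root, and marking a of the other m − r leaves and R − a of
-- these r leaves high gives r − R + 2a ascents; hence there are Σ_a [r + 2a = k + R] C(m−r, a) C(r, R−a)
-- markings with k ascents. Exchanging high with low and above with below makes the sum over r
-- symmetric in R and L = L_{α_i}, so R may be replaced by s = min(R, L). Summing over r then keeps only
-- r = k + s − 2a, and since 2k ≤ m gives k + s ≤ m, exactly the terms with a ≤ min(s, k) survive.
-- The counts are established by removing one leaf at a time; on the multinomial side this is the
-- Pascal rule Σ_{c : β_c > 0} mult(β − e_c) = mult(β).

module Submission where

open import Defs
open import Data.Bool using (Bool; true; false; not; if_then_else_)
import Data.Bool.Properties as Bool
open import Data.Empty using (⊥-elim)
open import Data.Fin using (Fin; zero; suc; toℕ)
import Data.Fin.Properties as Fin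
open import Data.Fin.Permutation using (Permutation′; _⟨$⟩ʳ_; _⟨$⟩ˡ_; inverseˡ)
open import Data.List using (List; []; _∷_; _++_; length; lookup; map; filter; allFin; concatMap; tabulate; applyUpTo; take; drop)
open import Data.List.Membership.Propositional using (_∈_)
open import Data.List.Membership.Propositional.Properties using (∈-allFin; ∈-filter⁻)
open import Data.List.Properties using (filter-≐; filter-all; filter-none; filter-++; length-++; map-tabulate; tabulate-lookup; map-∘)
import Data.List.Relation.Unary.All as All
open import Data.List.Relation.Unary.All.Properties using (all-filter)
open import Data.List.Relation.Unary.AllPairs using ([]; _∷_)
open import Data.List.Relation.Unary.Any using (here; there)
open import Data.List.Relation.Unary.Unique.Propositional using (Unique)
import Data.List.Relation.Unary.Unique.Propositional.Properties as Unique
open import Data.Nat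
open import Data.Nat.Combinatorics using (_C_; nCn≡1; nCk+nC[k+1]≡[n+1]C[k+1]; k![n∸k]!∣n!)
open import Data.Nat.Combinatorics.Specification using (k>n⇒nCk≡0; nCk≡n!/k![n-k]!)
open import Data.Nat.DivMod using (m*n/n≡m; m/n*n≡m)
open import Data.Nat.ListAction using (sum)
open import Data.Nat.Properties
open import Data.Nat.Tactic.RingSolver using (solve-∀)
open import Data.Product using (_×_; _,_; proj₁; proj₂)
open import Data.Sum using (_⊎_; inj₁; inj₂)
open import Data.Vec.Functional using () renaming (_∷_ to _∷ᶠ_)
open import Function using (_∘_; _⇔_; mk⇔; Equivalence)
open import Relation.Binary.Definitions using (DecidableEquality; _Respects_; tri<; tri≈; tri>)
open import Relation.Binary.PropositionalEquality
open import Relation.Nullary using (Dec; yes; no; does; ¬_)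
open import Relation.Nullary.Decidable using (dec-true; dec-false; _×-dec_)
open import Relation.Unary using (Pred; Decidable; _⊆_)
import Algebra.Properties.CommutativeMonoid.Sum as CommutativeMonoidSum
open import Algebra.Properties.CommutativeSemigroup *-commutativeSemigroup using (x∙yz≈y∙xz)

-- Only `does d` is inspected, so that e.g. 𝟙 (suc a ≟ suc b) and 𝟙 (a ≟ b) are definitionally equal.
𝟙 : ∀ {p} {P : Set p} → Dec P → ℕ
𝟙 d = if does d then 1 else 0

module _ {p} {P : Set p} where

  𝟙-yes : (d : Dec P) → P → 𝟙 d ≡ 1
  𝟙-yes d x = cong (λ b → if b then 1 else 0) (dec-true d x)

  𝟙-no : (d : Dec P) → ¬ P → 𝟙 d ≡ 0
  𝟙-no d ¬x = cong (λ b → if b then 1 else 0) (dec-false d ¬x)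

  𝟙≡0⇒¬ : (d : Dec P) → 𝟙 d ≡ 0 → ¬ P
  𝟙≡0⇒¬ (yes _) ()
  𝟙≡0⇒¬ (no ¬x) _ = ¬x

  𝟙-*-cong : (d : Dec P) {x y : ℕ} → (P → x ≡ y) → 𝟙 d * x ≡ 𝟙 d * y
  𝟙-*-cong (yes x) x≡y = cong (1 *_) (x≡y x)
  𝟙-*-cong (no _)  _   = refl

  𝟙-*-vanish : (d : Dec P) {x : ℕ} → (P → x ≡ 0) → 𝟙 d * x ≡ 0
  𝟙-*-vanish (yes x) x≡0 = trans (*-identityˡ _) (x≡0 x)
  𝟙-*-vanish (no _)  _   = refl

module _ {p q} {P : Set p} {Q : Set q} where

  𝟙-cong : (d : Dec P) (e : Dec Q) → (P → Q) → (Q → P) → 𝟙 d ≡ 𝟙 e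
  𝟙-cong (yes x) e P→Q Q→P = sym (𝟙-yes e (P→Q x))
  𝟙-cong (no ¬x) e P→Q Q→P = sym (𝟙-no e (¬x ∘ Q→P))

  𝟙-× : (d : Dec P) (e : Dec Q) → 𝟙 (d ×-dec e) ≡ 𝟙 d * 𝟙 e
  𝟙-× (yes _) (yes _) = refl
  𝟙-× (yes _) (no _)  = refl
  𝟙-× (no _)  _       = refl

sumBelow : ℕ → (ℕ → ℕ) → ℕ
sumBelow zero    f = 0
sumBelow (suc n) f = f 0 + sumBelow n (f ∘ suc)

sumBelow-cong : ∀ n {f g : ℕ → ℕ} → (∀ r → r < n → f r ≡ g r) → sumBelow n f ≡ sumBelow n g
sumBelow-cong zero    f≡g = refl
sumBelow-cong (suc n) f≡g =
  cong₂ _+_ (f≡g 0 z<s) (sumBelow-cong n (λ r r<n → f≡g (suc r) (s<s r<n)))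

sumBelow-zero : ∀ n {f : ℕ → ℕ} → (∀ r → r < n → f r ≡ 0) → sumBelow n f ≡ 0
sumBelow-zero zero    f≡0 = refl
sumBelow-zero (suc n) f≡0 =
  cong₂ _+_ (f≡0 0 z<s) (sumBelow-zero n (λ r r<n → f≡0 (suc r) (s<s r<n)))

sumBelow-+ : ∀ n (f g : ℕ → ℕ) → sumBelow n (λ r → f r + g r) ≡ sumBelow n f + sumBelow n g
sumBelow-+ zero    f g = refl
sumBelow-+ (suc n) f g rewrite sumBelow-+ n (f ∘ suc) (g ∘ suc) =
  shuffle (f 0) (g 0) (sumBelow n (f ∘ suc)) (sumBelow n (g ∘ suc))
  where shuffle : ∀ a b c d → a + b + (c + d) ≡ a + c + (b + d)
        shuffle = solve-∀

sumBelow-swap : ∀ n p (f : ℕ → ℕ → ℕ) →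
  sumBelow n (λ r → sumBelow p (f r)) ≡ sumBelow p (λ a → sumBelow n (λ r → f r a))
sumBelow-swap zero    p f = sym (sumBelow-zero p (λ _ _ → refl))
sumBelow-swap (suc n) p f = trans (cong (sumBelow p (f 0) +_) (sumBelow-swap n p (f ∘ suc)))
  (sym (sumBelow-+ p (f 0) (λ a → sumBelow n (λ r → f (suc r) a))))

sumBelow-last : ∀ n f → sumBelow (suc n) f ≡ sumBelow n f + f n
sumBelow-last zero    f = +-comm (f 0) 0
sumBelow-last (suc n) f =
  trans (cong (f 0 +_) (sumBelow-last n (f ∘ suc))) (sym (+-assoc (f 0) _ _))

sumBelow-reverse : ∀ n f → sumBelow (suc n) (λ r → f (n ∸ r)) ≡ sumBelow (suc n) f
sumBelow-reverse zero    f = refl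
sumBelow-reverse (suc n) f = begin
  f (suc n) + sumBelow (suc n) (λ r → f (n ∸ r)) ≡⟨ cong (f (suc n) +_) (sumBelow-reverse n f) ⟩
  f (suc n) + sumBelow (suc n) f                 ≡⟨ +-comm (f (suc n)) _ ⟩
  sumBelow (suc n) f + f (suc n)                 ≡⟨ sumBelow-last (suc n) f ⟨
  sumBelow (suc (suc n)) f                       ∎
  where open ≡-Reasoning

sumBelow-split : ∀ p q f → sumBelow (p + q) f ≡ sumBelow p f + sumBelow q (λ r → f (p + r))
sumBelow-split zero    q f = refl
sumBelow-split (suc p) q f =
  trans (cong (f 0 +_) (sumBelow-split p q (f ∘ suc))) (sym (+-assoc (f 0) _ _))

sumBelow-truncate : ∀ p n f → p ≤ n → (∀ a → p ≤ a → a < n → f a ≡ 0) → sumBelow n f ≡ sumBelow p f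
sumBelow-truncate p n f p≤n tail≡0 = begin
  sumBelow n f                                        ≡⟨ cong (λ x → sumBelow x f) (m+[n∸m]≡n p≤n) ⟨
  sumBelow (p + (n ∸ p)) f                            ≡⟨ sumBelow-split p (n ∸ p) f ⟩
  sumBelow p f + sumBelow (n ∸ p) (λ r → f (p + r))   ≡⟨ cong (sumBelow p f +_) (sumBelow-zero (n ∸ p) tail≡0′) ⟩
  sumBelow p f + 0                                    ≡⟨ +-identityʳ _ ⟩
  sumBelow p f                                        ∎
  where
  open ≡-Reasoning
  tail≡0′ : ∀ r → r < n ∸ p → f (p + r) ≡ 0
  tail≡0′ r r<n∸p = tail≡0 (p + r) (m≤m+n p r) (subst (p + r <_) (m+[n∸m]≡n p≤n) (+-monoʳ-< p r<n∸p))

sumBelow-𝟙≟ : ∀ n e (f : ℕ → ℕ) → e < n → sumBelow n (λ r → 𝟙 (r ≟ e) * f r) ≡ f e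
sumBelow-𝟙≟ (suc n) zero    f _ = begin
  1 * f 0 + sumBelow n (λ r → 0 * f (suc r)) ≡⟨ cong (1 * f 0 +_) (sumBelow-zero n (λ _ _ → refl)) ⟩
  1 * f 0 + 0                                ≡⟨ +-identityʳ _ ⟩
  1 * f 0                                    ≡⟨ *-identityˡ (f 0) ⟩
  f 0                                        ∎
  where open ≡-Reasoning
sumBelow-𝟙≟ (suc n) (suc e) f (s<s e<n) = sumBelow-𝟙≟ n e (f ∘ suc) e<n

sumBelow-𝟙+≟ : ∀ n {c d} (f : ℕ → ℕ) → c ≤ d → d ∸ c < n →
  sumBelow n (λ r → 𝟙 (r + c ≟ d) * f r) ≡ f (d ∸ c)
sumBelow-𝟙+≟ n {c} {d} f c≤d d∸c<n =
  trans (sumBelow-cong n (λ r _ → cong (_* f r) (𝟙-cong (r + c ≟ d) (r ≟ d ∸ c) (to r) (from r))))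
        (sumBelow-𝟙≟ n (d ∸ c) f d∸c<n)
  where
  to : ∀ r → r + c ≡ d → r ≡ d ∸ c
  to r refl = sym (m+n∸n≡m r c)
  from : ∀ r → r ≡ d ∸ c → r + c ≡ d
  from r refl = m∸n+n≡m c≤d

sumBelow-𝟙+≟-vanish : ∀ n {c d} (f : ℕ → ℕ) → d < c → sumBelow n (λ r → 𝟙 (r + c ≟ d) * f r) ≡ 0
sumBelow-𝟙+≟-vanish n {c} {d} f d<c =
  sumBelow-zero n (λ r _ → cong (_* f r) (𝟙-no (r + c ≟ d) (λ r+c≡d → <⇒≱ d<c (subst (c ≤_) r+c≡d (m≤n+m c r)))))

private
  module ∑ = CommutativeMonoidSum +-0-commutativeMonoid

module _ {a} {A : Set a} where

  sumMap : List A → (A → ℕ) → ℕ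
  sumMap xs f = sum (map f xs)

  sumMap-cong∈ : ∀ xs {f g : A → ℕ} → (∀ x → x ∈ xs → f x ≡ g x) → sumMap xs f ≡ sumMap xs g
  sumMap-cong∈ []       f≡g = refl
  sumMap-cong∈ (x ∷ xs) f≡g = cong₂ _+_ (f≡g x (here refl)) (sumMap-cong∈ xs (λ y y∈xs → f≡g y (there y∈xs)))

  sumMap-cong : ∀ xs {f g : A → ℕ} → (∀ x → f x ≡ g x) → sumMap xs f ≡ sumMap xs g
  sumMap-cong xs f≡g = sumMap-cong∈ xs (λ x _ → f≡g x)

  sumMap-zero : ∀ xs {f : A → ℕ} → (∀ x → f x ≡ 0) → sumMap xs f ≡ 0
  sumMap-zero []       f≡0 = refl
  sumMap-zero (x ∷ xs) f≡0 = cong₂ _+_ (f≡0 x) (sumMap-zero xs f≡0)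

  sumMap-+ : ∀ xs (f g : A → ℕ) → sumMap xs (λ x → f x + g x) ≡ sumMap xs f + sumMap xs g
  sumMap-+ []       f g = refl
  sumMap-+ (x ∷ xs) f g rewrite sumMap-+ xs f g = shuffle (f x) (g x) (sumMap xs f) (sumMap xs g)
    where shuffle : ∀ a b c d → a + b + (c + d) ≡ a + c + (b + d)
          shuffle = solve-∀

  *-distribˡ-sumMap : ∀ xs c (f : A → ℕ) → sumMap xs (λ x → c * f x) ≡ c * sumMap xs f
  *-distribˡ-sumMap []       c f = sym (*-zeroʳ c)
  *-distribˡ-sumMap (x ∷ xs) c f rewrite *-distribˡ-sumMap xs c f = sym (*-distribˡ-+ c (f x) _)

  sumMap-filter : ∀ {p} {P : Pred A p} (P? : Decidable P) xs (f : A → ℕ) →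
    sumMap (filter P? xs) f ≡ sumMap xs (λ x → 𝟙 (P? x) * f x)
  sumMap-filter P? []       f = refl
  sumMap-filter P? (x ∷ xs) f with P? x
  ... | yes _ = cong₂ _+_ (sym (+-identityʳ (f x))) (sumMap-filter P? xs f)
  ... | no  _ = sumMap-filter P? xs f

  length-filter-map : ∀ {b p} {B : Set b} {P : Pred B p} (P? : Decidable P) (h : A → B) xs →
    length (filter P? (map h xs)) ≡ length (filter (P? ∘ h) xs)
  length-filter-map P? h []       = refl
  length-filter-map P? h (x ∷ xs) with P? (h x)
  ... | yes _ = cong suc (length-filter-map P? h xs)
  ... | no  _ = length-filter-map P? h xs

  length-filter-concatMap : ∀ {b p} {B : Set b} {P : Pred B p} (P? : Decidable P) (F : A → List B) xs →
    length (filter P? (concatMap F xs)) ≡ sumMap xs (λ x → length (filter P? (F x)))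
  length-filter-concatMap P? F []       = refl
  length-filter-concatMap P? F (x ∷ xs) = begin
    length (filter P? (F x ++ concatMap F xs))
      ≡⟨ cong length (filter-++ P? (F x) (concatMap F xs)) ⟩
    length (filter P? (F x) ++ filter P? (concatMap F xs))
      ≡⟨ length-++ (filter P? (F x)) ⟩
    length (filter P? (F x)) + length (filter P? (concatMap F xs))
      ≡⟨ cong (length (filter P? (F x)) +_) (length-filter-concatMap P? F xs) ⟩
    length (filter P? (F x)) + sumMap xs (λ y → length (filter P? (F y))) ∎
    where open ≡-Reasoning

  length-filter-cong : ∀ {p q} {P : Pred A p} {Q : Pred A q} (P? : Decidable P) (Q? : Decidable Q) xs →
    P ⊆ Q → Q ⊆ P → length (filter P? xs) ≡ length (filter Q? xs)
  length-filter-cong P? Q? xs P⊆Q Q⊆P = cong length (filter-≐ P? Q? (P⊆Q , Q⊆P) xs)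

  length-filter-none : ∀ {p} {P : Pred A p} (P? : Decidable P) xs → (∀ x → ¬ P x) → length (filter P? xs) ≡ 0
  length-filter-none P? xs ¬P = cong length (filter-none P? {xs} (All.tabulate (λ {x} _ → ¬P x)))

filter-map : ∀ {a b p} {A : Set a} {B : Set b} {P : Pred B p} (P? : Decidable P) (f : A → B) xs →
  filter P? (map f xs) ≡ map f (filter (P? ∘ f) xs)
filter-map P? f []       = refl
filter-map P? f (x ∷ xs) with P? (f x)
... | yes _ = cong (f x ∷_) (filter-map P? f xs)
... | no  _ = filter-map P? f xs

sumMap≡0⇒∈≡0 : ∀ {a} {A : Set a} {xs} (f : A → ℕ) → sumMap xs f ≡ 0 → ∀ {x} → x ∈ xs → f x ≡ 0
sumMap≡0⇒∈≡0 {xs = y ∷ ys} f sum≡0 (here refl)  = m+n≡0⇒m≡0 (f y) sum≡0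
sumMap≡0⇒∈≡0 {xs = y ∷ ys} f sum≡0 (there x∈ys) = sumMap≡0⇒∈≡0 f (m+n≡0⇒n≡0 (f y) sum≡0) x∈ys

ΣFin-suc : ∀ n (f : Fin (suc n) → ℕ) → ΣFin (suc n) f ≡ f zero + ΣFin n (f ∘ suc)
ΣFin-suc n f = cong (λ xs → f zero + sum xs) (trans (map-tabulate suc f) (sym (map-tabulate (λ x → x) (f ∘ suc))))

countFin-tail : ∀ n {P : Pred (Fin (suc n)) _} (P? : Decidable P) →
  length (filter P? (tabulate suc)) ≡ countFin n (P? ∘ suc)
countFin-tail n P? =
  trans (cong (length ∘ filter P?) (sym (map-tabulate {n = n} (λ x → x) suc))) (length-filter-map P? suc (allFin n))

countFin-suc : ∀ n {P : Pred (Fin (suc n)) _} (P? : Decidable P) →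
  countFin (suc n) P? ≡ 𝟙 (P? zero) + countFin n (P? ∘ suc)
countFin-suc n P? with P? zero
... | yes _ = cong suc (countFin-tail n P?)
... | no  _ = countFin-tail n P?

countFin-cong : ∀ n {P Q : Pred (Fin n) _} (P? : Decidable P) (Q? : Decidable Q) →
  P ⊆ Q → Q ⊆ P → countFin n P? ≡ countFin n Q?
countFin-cong n P? Q? = length-filter-cong P? Q? (allFin n)

countFin-none : ∀ n {P : Pred (Fin n) _} (P? : Decidable P) → (∀ x → ¬ P x) → countFin n P? ≡ 0
countFin-none n P? = length-filter-none P? (allFin n)

countFin≡ΣFin : ∀ n {P : Pred (Fin n) _} (P? : Decidable P) → countFin n P? ≡ ΣFin n (𝟙 ∘ P?)
countFin≡ΣFin zero    P? = refl
countFin≡ΣFin (suc n) P? = begin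
  countFin (suc n) P?                  ≡⟨ countFin-suc n P? ⟩
  𝟙 (P? zero) + countFin n (P? ∘ suc)  ≡⟨ cong (𝟙 (P? zero) +_) (countFin≡ΣFin n (P? ∘ suc)) ⟩
  𝟙 (P? zero) + ΣFin n (𝟙 ∘ P? ∘ suc)  ≡⟨ ΣFin-suc n (𝟙 ∘ P?) ⟨
  ΣFin (suc n) (𝟙 ∘ P?)                ∎
  where open ≡-Reasoning

ΣFin≡∑ : ∀ n (f : Fin n → ℕ) → ΣFin n f ≡ ∑.sum f
ΣFin≡∑ zero    f = refl
ΣFin≡∑ (suc n) f = trans (ΣFin-suc n f) (cong (f zero +_) (ΣFin≡∑ n (f ∘ suc)))

ΣFin-permute : ∀ n (f : Fin n → ℕ) (π : Permutation′ n) → ΣFin n (f ∘ (π ⟨$⟩ʳ_)) ≡ ΣFin n f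
ΣFin-permute n f π = begin
  ΣFin n (f ∘ (π ⟨$⟩ʳ_)) ≡⟨ ΣFin≡∑ n (f ∘ (π ⟨$⟩ʳ_)) ⟩
  ∑.sum (f ∘ (π ⟨$⟩ʳ_))  ≡⟨ ∑.sum-permute f π ⟨
  ∑.sum f                ≡⟨ ΣFin≡∑ n f ⟨
  ΣFin n f               ∎
  where open ≡-Reasoning

countFin-permute : ∀ n {P : Pred (Fin n) _} (P? : Decidable P) (π : Permutation′ n) →
  countFin n (P? ∘ (π ⟨$⟩ʳ_)) ≡ countFin n P?
countFin-permute n P? π = begin
  countFin n (P? ∘ (π ⟨$⟩ʳ_)) ≡⟨ countFin≡ΣFin n (P? ∘ (π ⟨$⟩ʳ_)) ⟩
  ΣFin n (𝟙 ∘ P? ∘ (π ⟨$⟩ʳ_)) ≡⟨ ΣFin-permute n (𝟙 ∘ P?) π ⟩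
  ΣFin n (𝟙 ∘ P?)             ≡⟨ countFin≡ΣFin n P? ⟨
  countFin n P?               ∎
  where open ≡-Reasoning

ΣFin-𝟙≟ : ∀ n (i : Fin n) (f : Fin n → ℕ) → ΣFin n (λ c → 𝟙 (c Fin.≟ i) * f c) ≡ f i
ΣFin-𝟙≟ (suc n) zero f = begin
  ΣFin (suc n) (λ c → 𝟙 (c Fin.≟ zero) * f c) ≡⟨ ΣFin-suc n _ ⟩
  1 * f zero + ΣFin n (λ c → 0 * f (suc c)) ≡⟨ cong (1 * f zero +_) (sumMap-zero (allFin n) (λ _ → refl)) ⟩
  1 * f zero + 0                            ≡⟨ +-identityʳ _ ⟩
  1 * f zero                                ≡⟨ *-identityˡ (f zero) ⟩
  f zero                                    ∎
  where open ≡-Reasoning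
ΣFin-𝟙≟ (suc n) (suc i) f = trans (ΣFin-suc n (λ c → 𝟙 (c Fin.≟ suc i) * f c)) (ΣFin-𝟙≟ n i (f ∘ suc))

ΣFin-toℕ : ∀ n (f : ℕ → ℕ) → ΣFin n (f ∘ toℕ) ≡ sumBelow n f
ΣFin-toℕ zero    f = refl
ΣFin-toℕ (suc n) f = trans (ΣFin-suc n (f ∘ toℕ)) (cong (f 0 +_) (ΣFin-toℕ n (f ∘ suc)))

sum-map-applyUpTo : ∀ n (f g : ℕ → ℕ) → sum (map f (applyUpTo g n)) ≡ sumBelow n (f ∘ g)
sum-map-applyUpTo zero    f g = refl
sum-map-applyUpTo (suc n) f g = cong (f (g 0) +_) (sum-map-applyUpTo n f (g ∘ suc))

countFin≡0⇒¬ : ∀ n {P : Pred (Fin n) _} (P? : Decidable P) → countFin n P? ≡ 0 → ∀ x → ¬ P x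
countFin≡0⇒¬ n P? count≡0 x =
  𝟙≡0⇒¬ (P? x) (sumMap≡0⇒∈≡0 (𝟙 ∘ P?) (trans (sym (countFin≡ΣFin n P?)) count≡0) (∈-allFin x))

countFin-toℕ< : ∀ n c → c ≤ n → countFin n (λ u → toℕ u <? c) ≡ c
countFin-toℕ< zero    zero    _       = refl
countFin-toℕ< (suc n) zero    _       = countFin-none (suc n) (λ u → toℕ u <? 0) (λ _ ())
countFin-toℕ< (suc n) (suc c) (s≤s c≤n) = begin
  countFin (suc n) (λ u → toℕ u <? suc c)    ≡⟨ countFin-suc n (λ u → toℕ u <? suc c) ⟩
  suc (countFin n (λ u → suc (toℕ u) <? suc c)) ≡⟨ cong suc (countFin-cong n _ (λ u → toℕ u <? c) s≤s⁻¹ s≤s) ⟩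
  suc (countFin n (λ u → toℕ u <? c))        ≡⟨ cong suc (countFin-toℕ< n c c≤n) ⟩
  suc c                                      ∎
  where open ≡-Reasoning

countFin-true+false : ∀ m (f : Fin m → Bool) →
  countFin m (λ v → f v Bool.≟ true) + countFin m (λ v → f v Bool.≟ false) ≡ m
countFin-true+false zero    f = refl
countFin-true+false (suc m) f
  rewrite countFin-suc m (λ v → f v Bool.≟ true) | countFin-suc m (λ v → f v Bool.≟ false) with f zero
... | true  = cong suc (countFin-true+false m (f ∘ suc))
... | false = trans (+-suc _ _) (cong suc (countFin-true+false m (f ∘ suc)))

module _ {n m : ℕ} where

  -- allFuns builds its functions with a pattern-matching λ rather than _∷ᶠ_, hence the respect hypothesis.
  countFuns-suc : {P : Pred (Fin (suc n) → Fin m) _} (P? : Decidable P) → P Respects _≗_ →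
    countFuns (suc n) m P? ≡ ΣFin m (λ c → countFuns n m (λ g → P? (c ∷ᶠ g)))
  countFuns-suc P? resp = trans (length-filter-concatMap P? _ (allFin m)) (sumMap-cong (allFin m) (λ c →
    trans (length-filter-map P? _ (allFuns n m))
          (length-filter-cong _ _ (allFuns n m) (resp λ { zero → refl ; (suc x) → refl })
                                                (resp λ { zero → refl ; (suc x) → refl }))))

  countFuns-cong : {P Q : Pred (Fin n → Fin m) _} (P? : Decidable P) (Q? : Decidable Q) →
    P ⊆ Q → Q ⊆ P → countFuns n m P? ≡ countFuns n m Q?
  countFuns-cong P? Q? = length-filter-cong P? Q? (allFuns n m)

  countFuns-none : {P : Pred (Fin n → Fin m) _} (P? : Decidable P) → (∀ g → ¬ P g) → countFuns n m P? ≡ 0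
  countFuns-none P? = length-filter-none P? (allFuns n m)

  countFuns-const× : {Q : Set} {P : Pred (Fin n → Fin m) _} (Q? : Dec Q) (P? : Decidable P) →
    countFuns n m (λ g → Q? ×-dec P? g) ≡ 𝟙 Q? * countFuns n m P?
  countFuns-const× (yes q) P? = trans (countFuns-cong _ P? proj₂ (q ,_)) (sym (*-identityˡ _))
  countFuns-const× (no ¬q) P? = countFuns-none _ (λ g → ¬q ∘ proj₁)

countFuns-zero-const : ∀ {m} {Q : Set} (Q? : Dec Q) → countFuns 0 m (λ _ → Q?) ≡ 𝟙 Q?
countFuns-zero-const (yes _) = refl
countFuns-zero-const (no _)  = refl

allFin-suc : ∀ n → allFin (suc n) ≡ zero ∷ map suc (allFin n)
allFin-suc n = cong (zero ∷_) (sym (map-tabulate (λ x → x) suc))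

map-lookup-allFin : ∀ (α : List ℕ) → map (lookup α) (allFin (length α)) ≡ α
map-lookup-allFin α = trans (map-tabulate (λ x → x) (lookup α)) (tabulate-lookup α)

map-lookup-filter-suc : ∀ a (α : List ℕ) {P : Fin (suc (length α)) → Set} (P? : ∀ c → Dec (P c)) →
  map (lookup (a ∷ α)) (filter P? (map suc (allFin (length α)))) ≡ map (lookup α) (filter (P? ∘ suc) (allFin (length α)))
map-lookup-filter-suc a α P? = trans (cong (map (lookup (a ∷ α))) (filter-map P? suc (allFin (length α))))
                                     (sym (map-∘ (filter (P? ∘ suc) (allFin (length α)))))

map-lookup-filter-> : ∀ (α : List ℕ) (i : Fin (length α)) →
  map (lookup α) (filter (λ c → toℕ i <? toℕ c) (allFin (length α))) ≡ drop (suc (toℕ i)) α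
map-lookup-filter-> (a ∷ α) i = begin
  map (lookup (a ∷ α)) (filter (λ c → toℕ i <? toℕ c) (allFin (suc (length α))))
    ≡⟨ cong (map (lookup (a ∷ α)) ∘ filter (λ c → toℕ i <? toℕ c)) (allFin-suc (length α)) ⟩
  map (lookup (a ∷ α)) (filter (λ c → toℕ i <? toℕ c) (map suc (allFin (length α))))
    ≡⟨ map-lookup-filter-suc a α (λ c → toℕ i <? toℕ c) ⟩
  map (lookup α) (filter (λ c → toℕ i <? suc (toℕ c)) (allFin (length α)))
    ≡⟨ tail i ⟩
  drop (suc (toℕ i)) (a ∷ α) ∎
  where
  open ≡-Reasoning
  tail : ∀ (i : Fin (suc (length α))) →
    map (lookup α) (filter (λ c → toℕ i <? suc (toℕ c)) (allFin (length α))) ≡ drop (toℕ i) α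
  tail zero    = trans (cong (map (lookup α)) (filter-all _ (All.universal (λ _ → s≤s z≤n) _))) (map-lookup-allFin α)
  tail (suc i) = trans (cong (map (lookup α)) (filter-≐ _ (λ c → toℕ i <? toℕ c) (s≤s⁻¹ , s≤s) (allFin (length α))))
                       (map-lookup-filter-> α i)

map-lookup-filter-< : ∀ (α : List ℕ) (i : Fin (length α)) →
  map (lookup α) (filter (λ c → toℕ c <? toℕ i) (allFin (length α))) ≡ take (toℕ i) α
map-lookup-filter-< (a ∷ α) zero    =
  cong (map (lookup (a ∷ α))) (filter-none (λ c → toℕ c <? 0) (All.universal (λ _ ()) (allFin (suc (length α)))))
map-lookup-filter-< (a ∷ α) (suc i) = begin
  map (lookup (a ∷ α)) (filter (λ c → toℕ c <? suc (toℕ i)) (allFin (suc (length α))))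
    ≡⟨ cong (map (lookup (a ∷ α)) ∘ filter (λ c → toℕ c <? suc (toℕ i))) (allFin-suc (length α)) ⟩
  a ∷ map (lookup (a ∷ α)) (filter (λ c → toℕ c <? suc (toℕ i)) (map suc (allFin (length α))))
    ≡⟨ cong (a ∷_) (map-lookup-filter-suc a α (λ c → toℕ c <? suc (toℕ i))) ⟩
  a ∷ map (lookup α) (filter (λ c → suc (toℕ c) <? suc (toℕ i)) (allFin (length α)))
    ≡⟨ cong (λ xs → a ∷ map (lookup α) xs) (filter-≐ _ (λ c → toℕ c <? toℕ i) (s≤s⁻¹ , s≤s) (allFin (length α))) ⟩
  a ∷ map (lookup α) (filter (λ c → toℕ c <? toℕ i) (allFin (length α)))
    ≡⟨ cong (a ∷_) (map-lookup-filter-< α i) ⟩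
  take (suc (toℕ i)) (a ∷ α) ∎
  where open ≡-Reasoning

sum-take-lookup-drop : ∀ (α : List ℕ) (i : Fin (length α)) →
  sum (take (toℕ i) α) + lookup α i + sum (drop (suc (toℕ i)) α) ≡ sum α
sum-take-lookup-drop (a ∷ α) zero    = refl
sum-take-lookup-drop (a ∷ α) (suc i) =
  trans (assoc a (sum (take (toℕ i) α)) (lookup α i) (sum (drop (suc (toℕ i)) α))) (cong (a +_) (sum-take-lookup-drop α i))
  where assoc : ∀ a b c d → a + b + c + d ≡ a + (b + c + d)
        assoc = solve-∀

-- Binomial and multinomial coefficients

C*!*!≡! : ∀ a b → ((a + b) C a) * (a ! * b !) ≡ (a + b) !
C*!*!≡! a b = begin
  ((a + b) C a) * (a ! * b !)
    ≡⟨ cong (λ x → ((a + b) C a) * (a ! * x !)) (m+n∸m≡n a b) ⟨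
  ((a + b) C a) * (a ! * (a + b ∸ a) !)
    ≡⟨ cong (_* (a ! * (a + b ∸ a) !)) (nCk≡n!/k![n-k]! (m≤m+n a b)) ⟩
  ((a + b) ! / (a ! * (a + b ∸ a) !)) * (a ! * (a + b ∸ a) !)
    ≡⟨ m/n*n≡m (k![n∸k]!∣n! (m≤m+n a b)) ⟩
  (a + b) !                                                         ∎
  where
  open ≡-Reasoning
  instance
    a!≢0 : NonZero (a !)
    a!≢0 = a !≢0
    b!≢0 : NonZero ((a + b ∸ a) !)
    b!≢0 = (a + b ∸ a) !≢0
    a!b!≢0 : NonZero (a ! * (a + b ∸ a) !)
    a!b!≢0 = m*n≢0 (a !) ((a + b ∸ a) !)

multinomial : List ℕ → ℕ
multinomial []      = 1
multinomial (b ∷ β) = ((b + sum β) C b) * multinomial β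

multinomial*prodFact : ∀ β → multinomial β * prodFact β ≡ (sum β) !
multinomial*prodFact []      = refl
multinomial*prodFact (b ∷ β) = begin
  ((b + sum β) C b) * multinomial β * (b ! * prodFact β)
    ≡⟨ shuffle ((b + sum β) C b) (multinomial β) (b !) (prodFact β) ⟩
  ((b + sum β) C b) * b ! * (multinomial β * prodFact β)
    ≡⟨ cong (((b + sum β) C b) * b ! *_) (multinomial*prodFact β) ⟩
  ((b + sum β) C b) * b ! * (sum β) !
    ≡⟨ *-assoc ((b + sum β) C b) (b !) ((sum β) !) ⟩
  ((b + sum β) C b) * (b ! * (sum β) !)
    ≡⟨ C*!*!≡! b (sum β) ⟩
  (b + sum β) !                                            ∎
  where
  open ≡-Reasoning
  shuffle : ∀ x y z w → x * y * (z * w) ≡ x * z * (y * w)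
  shuffle = solve-∀

mult≡multinomial : ∀ β → mult β ≡ multinomial β
mult≡multinomial β = begin
  (sum β) ! / prodFact β                      ≡⟨ cong (_/ prodFact β) (multinomial*prodFact β) ⟨
  multinomial β * prodFact β / prodFact β     ≡⟨ m*n/n≡m (multinomial β) (prodFact β) ⟩
  multinomial β                               ∎
  where
  open ≡-Reasoning
  instance _ = prodFact-nz β

sum≡0⇒multinomial≡1 : ∀ β → sum β ≡ 0 → multinomial β ≡ 1
sum≡0⇒multinomial≡1 []      _      = refl
sum≡0⇒multinomial≡1 (b ∷ β) sum≡0 = begin
  ((b + sum β) C b) * multinomial β ≡⟨ cong₂ (λ n r → (n C r) * multinomial β) sum≡0 (m+n≡0⇒m≡0 b sum≡0) ⟩
  1 * multinomial β                 ≡⟨ *-identityˡ (multinomial β) ⟩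
  multinomial β                     ≡⟨ sum≡0⇒multinomial≡1 β (m+n≡0⇒n≡0 b sum≡0) ⟩
  1                                 ∎
  where open ≡-Reasoning

𝟙*multinomial : ∀ β → 𝟙 (sum β ≟ 0) * multinomial β ≡ 𝟙 (sum β ≟ 0)
𝟙*multinomial β = trans (𝟙-*-cong (sum β ≟ 0) (sum≡0⇒multinomial≡1 β)) (*-identityʳ (𝟙 (sum β ≟ 0)))

C-pascal-𝟙 : ∀ a s →
  𝟙 (1 ≤? a) * (((a ∸ 1) + s) C (a ∸ 1)) + 𝟙 (1 ≤? s) * ((a + (s ∸ 1)) C a) ≡ 𝟙 (1 ≤? a + s) * ((a + s) C a)
C-pascal-𝟙 zero    s       = refl
C-pascal-𝟙 (suc a) zero    = begin
  1 * ((a + 0) C a) + 0          ≡⟨ cong (λ x → 1 * (x C a) + 0) (+-identityʳ a) ⟩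
  1 * (a C a) + 0                ≡⟨ cong (λ x → 1 * x + 0) (trans (nCn≡1 a) (sym (nCn≡1 (suc a)))) ⟩
  1 * (suc a C suc a) + 0        ≡⟨ +-identityʳ _ ⟩
  1 * (suc a C suc a)            ≡⟨ cong (λ x → 1 * (x C suc a)) (+-identityʳ (suc a)) ⟨
  1 * ((suc a + 0) C suc a)      ∎
  where open ≡-Reasoning
C-pascal-𝟙 (suc a) (suc s) = begin
  1 * ((a + suc s) C a) + 1 * ((suc a + s) C suc a)
    ≡⟨ cong (λ x → 1 * ((a + suc s) C a) + 1 * (x C suc a)) (+-suc a s) ⟨
  1 * ((a + suc s) C a) + 1 * ((a + suc s) C suc a)
    ≡⟨ *-distribˡ-+ 1 ((a + suc s) C a) _ ⟨
  1 * (((a + suc s) C a) + ((a + suc s) C suc a))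
    ≡⟨ cong (1 *_) (nCk+nC[k+1]≡[n+1]C[k+1] (a + suc s) a) ⟩
  1 * ((suc a + suc s) C suc a)                       ∎
  where open ≡-Reasoning

module _ {A : Set} (_≟_ : DecidableEquality A) where

  decrementAt : (A → ℕ) → A → A → ℕ
  decrementAt t c j = t j ∸ 𝟙 (c ≟ j)

  decrementAt-self : ∀ t c → decrementAt t c c ≡ t c ∸ 1
  decrementAt-self t c = cong (t c ∸_) (𝟙-yes (c ≟ c) refl)

  decrementAt-other : ∀ t {c j} → c ≢ j → decrementAt t c j ≡ t j
  decrementAt-other t {c} {j} c≢j = cong (t j ∸_) (𝟙-no (c ≟ j) c≢j)

  map-decrementAt-∉ : ∀ t c {xs} → All.All (c ≢_) xs → map (decrementAt t c) xs ≡ map t xs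
  map-decrementAt-∉ t c All.[]            = refl
  map-decrementAt-∉ t c (c≢x All.∷ c∉xs) = cong₂ _∷_ (decrementAt-other t c≢x) (map-decrementAt-∉ t c c∉xs)

  suc-sum-decrementAt : ∀ t {c xs} → Unique xs → c ∈ xs → 1 ≤ t c →
    suc (sum (map (decrementAt t c) xs)) ≡ sum (map t xs)
  suc-sum-decrementAt t {c} {_ ∷ xs} (c∉xs ∷ _) (here refl) 1≤tc = begin
    suc (decrementAt t c c + sum (map (decrementAt t c) xs))
      ≡⟨ cong₂ (λ x y → suc (x + sum y)) (decrementAt-self t c) (map-decrementAt-∉ t c c∉xs) ⟩
    suc (t c ∸ 1 + sum (map t xs))
      ≡⟨ cong (_+ sum (map t xs)) (m+[n∸m]≡n 1≤tc) ⟩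
    t c + sum (map t xs)                                     ∎
    where open ≡-Reasoning
  suc-sum-decrementAt t {c} {x ∷ xs} (x∉xs ∷ u) (there c∈xs) 1≤tc = begin
    suc (decrementAt t c x + sum (map (decrementAt t c) xs))
      ≡⟨ cong (λ y → suc (y + sum (map (decrementAt t c) xs))) (decrementAt-other t c≢x) ⟩
    suc (t x + sum (map (decrementAt t c) xs))
      ≡⟨ +-suc (t x) _ ⟨
    t x + suc (sum (map (decrementAt t c) xs))
      ≡⟨ cong (t x +_) (suc-sum-decrementAt t u c∈xs 1≤tc) ⟩
    t x + sum (map t xs)                                     ∎
    where
    open ≡-Reasoning
    c≢x : c ≢ x
    c≢x c≡x = All.lookup x∉xs c∈xs (sym c≡x)

  multinomial-decrementAt-∷ : ∀ t {c x xs} → Unique xs → c ∈ xs → c ≢ x →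
    𝟙 (1 ≤? t c) * multinomial (map (decrementAt t c) (x ∷ xs))
      ≡ ((t x + (sum (map t xs) ∸ 1)) C t x) * (𝟙 (1 ≤? t c) * multinomial (map (decrementAt t c) xs))
  multinomial-decrementAt-∷ t {c} {x} {xs} u c∈xs c≢x = begin
    𝟙 (1 ≤? t c) * (((decrementAt t c x + Sc) C decrementAt t c x) * Mc)
      ≡⟨ cong (λ d → 𝟙 (1 ≤? t c) * (((d + Sc) C d) * Mc)) (decrementAt-other t c≢x) ⟩
    𝟙 (1 ≤? t c) * (((t x + Sc) C t x) * Mc)
      ≡⟨ 𝟙-*-cong (1 ≤? t c) (λ 1≤tc → cong (λ s → ((t x + s) C t x) * Mc)
                                             (cong pred (suc-sum-decrementAt t u c∈xs 1≤tc))) ⟩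
    𝟙 (1 ≤? t c) * (((t x + (sum (map t xs) ∸ 1)) C t x) * Mc)
      ≡⟨ x∙yz≈y∙xz (𝟙 (1 ≤? t c)) ((t x + (sum (map t xs) ∸ 1)) C t x) Mc ⟩
    ((t x + (sum (map t xs) ∸ 1)) C t x) * (𝟙 (1 ≤? t c) * Mc) ∎
    where
    open ≡-Reasoning
    Sc Mc : ℕ
    Sc = sum (map (decrementAt t c) xs)
    Mc = multinomial (map (decrementAt t c) xs)

  multinomial-pascal : ∀ t {xs} → Unique xs →
    sumMap xs (λ c → 𝟙 (1 ≤? t c) * multinomial (map (decrementAt t c) xs))
      ≡ 𝟙 (1 ≤? sum (map t xs)) * multinomial (map t xs)
  multinomial-pascal t {[]}     []          = refl
  multinomial-pascal t {x ∷ xs} (x∉xs ∷ u) = begin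
    𝟙 (1 ≤? t x) * multinomial (map (decrementAt t x) (x ∷ xs))
      + sumMap xs (λ c → 𝟙 (1 ≤? t c) * multinomial (map (decrementAt t c) (x ∷ xs)))
      ≡⟨ cong₂ _+_ firstColor otherColors ⟩
    𝟙 (1 ≤? t x) * (((t x ∸ 1 + S) C (t x ∸ 1)) * M) + B * (𝟙 (1 ≤? S) * M)
      ≡⟨ factor (𝟙 (1 ≤? t x)) ((t x ∸ 1 + S) C (t x ∸ 1)) B (𝟙 (1 ≤? S)) M ⟩
    (𝟙 (1 ≤? t x) * ((t x ∸ 1 + S) C (t x ∸ 1)) + 𝟙 (1 ≤? S) * B) * M
      ≡⟨ cong (_* M) (C-pascal-𝟙 (t x) S) ⟩
    𝟙 (1 ≤? t x + S) * ((t x + S) C t x) * M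
      ≡⟨ *-assoc (𝟙 (1 ≤? t x + S)) _ M ⟩
    𝟙 (1 ≤? t x + S) * (((t x + S) C t x) * M) ∎
    where
    open ≡-Reasoning
    S M B : ℕ
    S = sum (map t xs)
    M = multinomial (map t xs)
    B = (t x + (S ∸ 1)) C t x
    factor : ∀ p q b r M → p * (q * M) + b * (r * M) ≡ (p * q + r * b) * M
    factor = solve-∀
    firstColor : 𝟙 (1 ≤? t x) * multinomial (map (decrementAt t x) (x ∷ xs))
                ≡ 𝟙 (1 ≤? t x) * (((t x ∸ 1 + S) C (t x ∸ 1)) * M)
    firstColor = cong₂ (λ d ds → 𝟙 (1 ≤? t x) * multinomial (d ∷ ds)) (decrementAt-self t x) (map-decrementAt-∉ t x x∉xs)
    otherColors : sumMap xs (λ c → 𝟙 (1 ≤? t c) * multinomial (map (decrementAt t c) (x ∷ xs)))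
                 ≡ B * (𝟙 (1 ≤? S) * M)
    otherColors = begin
      sumMap xs (λ c → 𝟙 (1 ≤? t c) * multinomial (map (decrementAt t c) (x ∷ xs)))
        ≡⟨ sumMap-cong∈ xs (λ c c∈xs →
             multinomial-decrementAt-∷ t u c∈xs (λ c≡x → All.lookup x∉xs c∈xs (sym c≡x))) ⟩
      sumMap xs (λ c → B * (𝟙 (1 ≤? t c) * multinomial (map (decrementAt t c) xs)))
        ≡⟨ *-distribˡ-sumMap xs B _ ⟩
      B * sumMap xs (λ c → 𝟙 (1 ≤? t c) * multinomial (map (decrementAt t c) xs))
        ≡⟨ cong (B *_) (multinomial-pascal t u) ⟩
      B * (𝟙 (1 ≤? S) * M) ∎

-- High/low markings of the leaves

ascentIfHigh ascentIfLow : Bool → ℕ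
ascentIfHigh true  = 1
ascentIfHigh false = 0
ascentIfLow b = ascentIfHigh (not b)

-- markings nu nd H L k counts the ways to mark H of nu + nd leaves high and the other L low so that
-- exactly k of them ascend, where nu leaves (those labeled above the root) ascend iff high and the
-- other nd iff low. markingStep b P marks one such leaf, labeled above the root iff b.
markingStep : Bool → (ℕ → ℕ → ℕ → ℕ) → ℕ → ℕ → ℕ → ℕ
markingStep b P H L k =
    𝟙 (1 ≤? H) * 𝟙 (ascentIfHigh b ≤? k) * P (H ∸ 1) L (k ∸ ascentIfHigh b)
  + 𝟙 (1 ≤? L) * 𝟙 (ascentIfLow b ≤? k) * P H (L ∸ 1) (k ∸ ascentIfLow b)

markings : (nu nd H L k : ℕ) → ℕ
markings zero     zero     H L k = 𝟙 (H ≟ 0) * 𝟙 (L ≟ 0) * 𝟙 (k ≟ 0)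
markings (suc nu) nd       H L k = markingStep true (markings nu nd) H L k
markings zero     (suc nd) H L k = markingStep false (markings zero nd) H L k

markingStep-cong : ∀ b {P Q : ℕ → ℕ → ℕ → ℕ} → (∀ H L k → P H L k ≡ Q H L k) →
  ∀ H L k → markingStep b P H L k ≡ markingStep b Q H L k
markingStep-cong b P≡Q H L k =
  cong₂ _+_ (cong (𝟙 (1 ≤? H) * 𝟙 (ascentIfHigh b ≤? k) *_) (P≡Q (H ∸ 1) L (k ∸ ascentIfHigh b)))
            (cong (𝟙 (1 ≤? L) * 𝟙 (ascentIfLow b ≤? k) *_) (P≡Q H (L ∸ 1) (k ∸ ascentIfLow b)))

markingStep-comm : ∀ P H L k →
  markingStep true (markingStep false P) H L k ≡ markingStep false (markingStep true P) H L k
markingStep-comm P H L k =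
  interchange (𝟙 (1 ≤? H)) (𝟙 (1 ≤? k)) (𝟙 (1 ≤? H ∸ 1)) (𝟙 (1 ≤? L)) (𝟙 (1 ≤? k ∸ 1)) (𝟙 (1 ≤? L ∸ 1))
        (P (H ∸ 1 ∸ 1) L (k ∸ 1)) (P (H ∸ 1) (L ∸ 1) (k ∸ 1 ∸ 1))
        (P (H ∸ 1) (L ∸ 1) k) (P H (L ∸ 1 ∸ 1) (k ∸ 1))
  where
  interchange : ∀ h k₁ h′ l k₁′ l′ A B C D →
    h * k₁ * (h′ * 1 * A + l * k₁′ * B) + l * 1 * (h * 1 * C + l′ * k₁ * D)
    ≡ h * 1 * (h′ * k₁ * A + l * 1 * C) + l * k₁ * (h * k₁′ * B + l′ * 1 * D)
  interchange = solve-∀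

markings-suc-below : ∀ nu nd H L k → markings nu (suc nd) H L k ≡ markingStep false (markings nu nd) H L k
markings-suc-below zero     nd H L k = refl
markings-suc-below (suc nu) nd H L k = begin
  markingStep true (markings nu (suc nd)) H L k
    ≡⟨ markingStep-cong true (markings-suc-below nu nd) H L k ⟩
  markingStep true (markingStep false (markings nu nd)) H L k
    ≡⟨ markingStep-comm (markings nu nd) H L k ⟩
  markingStep false (markings (suc nu) nd) H L k ∎
  where open ≡-Reasoning

markingStep-swap : ∀ b P H L k → markingStep b P H L k ≡ markingStep (not b) (λ L′ H′ → P H′ L′) L H k
markingStep-swap true  P H L k = +-comm (𝟙 (1 ≤? H) * 𝟙 (1 ≤? k) * P (H ∸ 1) L (k ∸ 1)) _
markingStep-swap false P H L k = +-comm (𝟙 (1 ≤? H) * 1 * P (H ∸ 1) L k) _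

markings-sym : ∀ nu nd H L k → markings nu nd H L k ≡ markings nd nu L H k
markings-sym zero zero H L k = swapFactors (𝟙 (H ≟ 0)) (𝟙 (L ≟ 0)) (𝟙 (k ≟ 0))
  where swapFactors : ∀ a b c → a * b * c ≡ b * a * c
        swapFactors = solve-∀
markings-sym (suc nu) nd H L k = begin
  markingStep true (markings nu nd) H L k
    ≡⟨ markingStep-cong true (markings-sym nu nd) H L k ⟩
  markingStep true (λ H′ L′ → markings nd nu L′ H′) H L k
    ≡⟨ markingStep-swap true (λ H′ L′ → markings nd nu L′ H′) H L k ⟩
  markingStep false (markings nd nu) L H k
    ≡⟨ markings-suc-below nd nu L H k ⟨
  markings nd (suc nu) L H k ∎
  where open ≡-Reasoning
markings-sym zero (suc nd) H L k = begin
  markingStep false (markings zero nd) H L k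
    ≡⟨ markingStep-cong false (markings-sym zero nd) H L k ⟩
  markingStep false (λ H′ L′ → markings nd zero L′ H′) H L k
    ≡⟨ markingStep-swap false (λ H′ L′ → markings nd zero L′ H′) H L k ⟩
  markings (suc nd) zero L H k ∎
  where open ≡-Reasoning

markings-allBelow : ∀ nd H L k → H + L ≡ nd → markings zero nd H L k ≡ 𝟙 (k ≟ L) * (nd C H)
markings-allBelow zero zero zero k refl = trans (*-identityˡ (𝟙 (k ≟ 0))) (sym (*-identityʳ (𝟙 (k ≟ 0))))
markings-allBelow (suc nd) zero .(suc nd) zero    refl = refl
markings-allBelow (suc nd) zero .(suc nd) (suc k) refl =
  trans (*-identityˡ (markings zero nd zero nd k)) (markings-allBelow nd zero nd k refl)
markings-allBelow (suc nd) (suc h) zero k h+0≡nd with trans (sym (+-identityʳ h)) (suc-injective h+0≡nd)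
... | refl = begin
  1 * 1 * markings zero h h zero k + 0 ≡⟨ unit (markings zero h h zero k) ⟩
  markings zero h h zero k            ≡⟨ markings-allBelow h h zero k (+-identityʳ h) ⟩
  𝟙 (k ≟ 0) * (h C h)                   ≡⟨ cong (𝟙 (k ≟ 0) *_) (trans (nCn≡1 h) (sym (nCn≡1 (suc h)))) ⟩
  𝟙 (k ≟ 0) * (suc h C suc h)           ∎
  where open ≡-Reasoning
        unit : ∀ x → 1 * 1 * x + 0 ≡ x
        unit = solve-∀
markings-allBelow (suc nd) (suc h) (suc l) zero    e =
  trans (+-identityʳ _) (trans (*-identityˡ _) (markings-allBelow nd h (suc l) zero (suc-injective e)))
markings-allBelow (suc nd) (suc h) (suc l) (suc k) e = begin
  1 * 1 * markings zero nd h (suc l) (suc k) + 1 * 1 * markings zero nd (suc h) l k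
    ≡⟨ cong₂ (λ x y → 1 * 1 * x + 1 * 1 * y) (markings-allBelow nd h (suc l) (suc k) (suc-injective e))
                                              (markings-allBelow nd (suc h) l k (trans (sym (+-suc h l)) (suc-injective e))) ⟩
  1 * 1 * (𝟙 (k ≟ l) * (nd C h)) + 1 * 1 * (𝟙 (k ≟ l) * (nd C suc h))
    ≡⟨ factor (𝟙 (k ≟ l)) (nd C h) (nd C suc h) ⟩
  𝟙 (k ≟ l) * ((nd C h) + (nd C suc h))
    ≡⟨ cong (𝟙 (k ≟ l) *_) (nCk+nC[k+1]≡[n+1]C[k+1] nd h) ⟩
  𝟙 (k ≟ l) * (suc nd C suc h) ∎
  where open ≡-Reasoning
        factor : ∀ x a b → 1 * 1 * (x * a) + 1 * 1 * (x * b) ≡ x * (a + b)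
        factor = solve-∀

-- Marking a of the nu leaves above the root and H − a of the nd below high gives a + (nd − (H − a)) ascents.
markingsClosed : (nu nd H k : ℕ) → ℕ
markingsClosed nu nd H k = sumBelow (suc H) (λ a → 𝟙 (nd + 2 * a ≟ k + H) * ((nu C a) * (nd C (H ∸ a))))

markingsClosed-zero : ∀ nd H k → markingsClosed zero nd H k ≡ 𝟙 (nd ≟ k + H) * (nd C H)
markingsClosed-zero nd H k = begin
  𝟙 (nd + 0 ≟ k + H) * (1 * (nd C H)) + sumBelow H (λ a → 𝟙 (nd + 2 * suc a ≟ k + H) * 0)
    ≡⟨ cong₂ (λ x y → 𝟙 (x ≟ k + H) * (1 * (nd C H)) + y) (+-identityʳ nd)
             (sumBelow-zero H (λ a _ → *-zeroʳ (𝟙 (nd + 2 * suc a ≟ k + H)))) ⟩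
  𝟙 (nd ≟ k + H) * (1 * (nd C H)) + 0
    ≡⟨ trans (+-identityʳ _) (cong (𝟙 (nd ≟ k + H) *_) (*-identityˡ (nd C H))) ⟩
  𝟙 (nd ≟ k + H) * (nd C H) ∎
  where open ≡-Reasoning

markingsClosed-vanish : ∀ nu nd H k → nu + nd < H → markingsClosed nu nd H k ≡ 0
markingsClosed-vanish nu nd H k nu+nd<H =
  sumBelow-zero (suc H) (λ a _ → trans (cong (𝟙 (nd + 2 * a ≟ k + H) *_) (binomials≡0 a))
                                       (*-zeroʳ (𝟙 (nd + 2 * a ≟ k + H))))
  where
  binomials≡0 : ∀ a → (nu C a) * (nd C (H ∸ a)) ≡ 0
  binomials≡0 a with nu <? a
  ... | yes nu<a = cong (_* (nd C (H ∸ a))) (k>n⇒nCk≡0 nu<a)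
  ... | no  nu≮a = trans (cong ((nu C a) *_) (k>n⇒nCk≡0 nd<H∸a)) (*-zeroʳ (nu C a))
    where
    nd<H∸a : nd < H ∸ a
    nd<H∸a = m+n≤o⇒m≤o∸n (suc nd) (begin
      suc nd + a  ≡⟨ cong suc (+-comm nd a) ⟩
      suc a + nd  ≤⟨ s≤s (+-monoˡ-≤ nd (≮⇒≥ nu≮a)) ⟩
      suc nu + nd ≤⟨ nu+nd<H ⟩
      H           ∎)
      where open ≤-Reasoning

firstHighClosed : (nu nd H k : ℕ) → ℕ
firstHighClosed nu nd H k = sumBelow H (λ a → 𝟙 (nd + 2 * suc a ≟ k + H) * ((nu C a) * (nd C (H ∸ suc a))))

markingsClosed-suc-up : ∀ nu nd H k →
  markingsClosed (suc nu) nd H k ≡ markingsClosed nu nd H k + firstHighClosed nu nd H k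
markingsClosed-suc-up nu nd H k = begin
  t₀ + sumBelow H (λ a → δ a * ((suc nu C suc a) * b a))
    ≡⟨ cong (t₀ +_) (sumBelow-cong H (λ a _ → pascal a)) ⟩
  t₀ + sumBelow H (λ a → δ a * ((nu C suc a) * b a) + δ a * ((nu C a) * b a))
    ≡⟨ cong (t₀ +_) (sumBelow-+ H _ _) ⟩
  t₀ + (sumBelow H (λ a → δ a * ((nu C suc a) * b a)) + firstHighClosed nu nd H k)
    ≡⟨ +-assoc t₀ _ _ ⟨
  markingsClosed nu nd H k + firstHighClosed nu nd H k ∎
  where
  open ≡-Reasoning
  t₀ : ℕ
  t₀ = 𝟙 (nd + 2 * 0 ≟ k + H) * (1 * (nd C H))
  δ : ℕ → ℕ
  δ a = 𝟙 (nd + 2 * suc a ≟ k + H)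
  b : ℕ → ℕ
  b a = nd C (H ∸ suc a)
  pascal : ∀ a → δ a * ((suc nu C suc a) * b a) ≡ δ a * ((nu C suc a) * b a) + δ a * ((nu C a) * b a)
  pascal a = begin
    δ a * ((suc nu C suc a) * b a)                   ≡⟨ cong (λ x → δ a * (x * b a)) (nCk+nC[k+1]≡[n+1]C[k+1] nu a) ⟨
    δ a * (((nu C a) + (nu C suc a)) * b a)          ≡⟨ distribute (δ a) (nu C a) (nu C suc a) (b a) ⟩
    δ a * ((nu C suc a) * b a) + δ a * ((nu C a) * b a) ∎
    where distribute : ∀ d x y z → d * ((x + y) * z) ≡ d * (y * z) + d * (x * z)
          distribute = solve-∀

firstHighClosed-suc : ∀ nu nd H k → firstHighClosed nu nd (suc H) k ≡ 𝟙 (1 ≤? k) * markingsClosed nu nd H (k ∸ 1)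
firstHighClosed-suc nu nd H zero = sumBelow-zero (suc H) (λ a _ →
  𝟙-*-vanish (nd + 2 * suc a ≟ suc H) (λ e → trans (cong ((nu C a) *_) (k>n⇒nCk≡0 (nd<H∸a a e))) (*-zeroʳ (nu C a))))
  where
  nd<H∸a : ∀ a → nd + 2 * suc a ≡ suc H → nd < H ∸ a
  nd<H∸a a e = m+n≤o⇒m≤o∸n (suc nd) (≤-trans (m≤m+n (suc nd + a) a) (≤-reflexive (suc-injective (trans (expand nd a) e))))
    where expand : ∀ nd a → suc (suc nd + a + a) ≡ nd + 2 * suc a
          expand = solve-∀
firstHighClosed-suc nu nd H (suc k) = begin
  sumBelow (suc H) (λ a → 𝟙 (nd + 2 * suc a ≟ suc k + suc H) * ((nu C a) * (nd C (H ∸ a))))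
    ≡⟨ sumBelow-cong (suc H) (λ a _ →
         cong₂ (λ x y → 𝟙 (x ≟ y) * ((nu C a) * (nd C (H ∸ a)))) (twoMore nd a) (twoMore′ k H)) ⟩
  markingsClosed nu nd H k
    ≡⟨ *-identityˡ (markingsClosed nu nd H k) ⟨
  1 * markingsClosed nu nd H k ∎
  where
  open ≡-Reasoning
  twoMore : ∀ nd a → nd + 2 * suc a ≡ suc (suc (nd + 2 * a))
  twoMore = solve-∀
  twoMore′ : ∀ k H → suc k + suc H ≡ suc (suc (k + H))
  twoMore′ = solve-∀

markings≡markingsClosed : ∀ nu nd H L k → H + L ≡ nu + nd → markings nu nd H L k ≡ markingsClosed nu nd H k
markings≡markingsClosed zero nd H L k H+L≡nd = begin
  markings zero nd H L k     ≡⟨ markings-allBelow nd H L k H+L≡nd ⟩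
  𝟙 (k ≟ L) * (nd C H)       ≡⟨ cong (_* (nd C H)) (𝟙-cong (k ≟ L) (nd ≟ k + H) to from) ⟩
  𝟙 (nd ≟ k + H) * (nd C H)  ≡⟨ markingsClosed-zero nd H k ⟨
  markingsClosed zero nd H k ∎
  where
  open ≡-Reasoning
  to : k ≡ L → nd ≡ k + H
  to refl = trans (sym H+L≡nd) (+-comm H k)
  from : nd ≡ k + H → k ≡ L
  from nd≡k+H = +-cancelʳ-≡ H k L (trans (sym nd≡k+H) (trans (sym H+L≡nd) (+-comm H L)))
markings≡markingsClosed (suc nu) nd H L k H+L≡1+nu+nd = begin
  markingStep true (markings nu nd) H L k
    ≡⟨ cong₂ _+_ (markHigh H H+L≡1+nu+nd) (markLow L H+L≡1+nu+nd) ⟩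
  firstHighClosed nu nd H k + markingsClosed nu nd H k
    ≡⟨ +-comm (firstHighClosed nu nd H k) _ ⟩
  markingsClosed nu nd H k + firstHighClosed nu nd H k
    ≡⟨ markingsClosed-suc-up nu nd H k ⟨
  markingsClosed (suc nu) nd H k ∎
  where
  open ≡-Reasoning
  markHigh : ∀ H → H + L ≡ suc nu + nd →
    𝟙 (1 ≤? H) * 𝟙 (1 ≤? k) * markings nu nd (H ∸ 1) L (k ∸ 1) ≡ firstHighClosed nu nd H k
  markHigh zero    _ = refl
  markHigh (suc h) e = begin
    1 * 𝟙 (1 ≤? k) * markings nu nd h L (k ∸ 1)
      ≡⟨ cong₂ _*_ (*-identityˡ (𝟙 (1 ≤? k))) (markings≡markingsClosed nu nd h L (k ∸ 1) (suc-injective e)) ⟩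
    𝟙 (1 ≤? k) * markingsClosed nu nd h (k ∸ 1)
      ≡⟨ firstHighClosed-suc nu nd h k ⟨
    firstHighClosed nu nd (suc h) k ∎
  markLow : ∀ L → H + L ≡ suc nu + nd → 𝟙 (1 ≤? L) * 1 * markings nu nd H (L ∸ 1) k ≡ markingsClosed nu nd H k
  markLow zero    e = sym (markingsClosed-vanish nu nd H k (≤-reflexive (trans (sym e) (+-identityʳ H))))
  markLow (suc l) e = trans (*-identityˡ (markings nu nd H l k))
    (markings≡markingsClosed nu nd H l k (suc-injective (trans (sym (+-suc H l)) e)))

rootSumTerm : (m s k j : ℕ) → ℕ
rootSumTerm m s k j = (((s ∸ j) + (k ∸ j)) C (s ∸ j)) * ((((m ∸ s) ∸ k) + 2 * j) C j)

closedSummand : (m H k a r : ℕ) → ℕ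
closedSummand m H k a r = 𝟙 (r + 2 * a ≟ k + H) * (((m ∸ r) C a) * (r C (H ∸ a)))

m∸[h+κ]≡m∸[a+h]∸[a+κ]+2a : ∀ m a h κ → a + κ + (a + h) ≤ m → m ∸ (h + κ) ≡ m ∸ (a + h) ∸ (a + κ) + 2 * a
m∸[h+κ]≡m∸[a+h]∸[a+κ]+2a m a h κ ≤m = begin
  m ∸ (h + κ)                     ≡⟨ cong (_∸ (h + κ)) m≡ ⟨
  X + 2 * a + (h + κ) ∸ (h + κ)   ≡⟨ m+n∸n≡m (X + 2 * a) (h + κ) ⟩
  X + 2 * a                       ≡⟨ cong (_+ 2 * a) (∸-+-assoc m (a + h) (a + κ)) ⟨
  m ∸ (a + h) ∸ (a + κ) + 2 * a   ∎
  where
  open ≡-Reasoning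
  X : ℕ
  X = m ∸ (a + h + (a + κ))
  reassoc : ∀ X a h κ → X + 2 * a + (h + κ) ≡ X + (a + h + (a + κ))
  reassoc = solve-∀
  m≡ : X + 2 * a + (h + κ) ≡ m
  m≡ = trans (reassoc X a h κ) (m∸n+n≡m (subst (_≤ m) (+-comm (a + κ) (a + h)) ≤m))

sumBelow-closedSummand : ∀ m H k a → a ≤ H → a ≤ k → k + H ≤ m →
  sumBelow (suc m) (closedSummand m H k a) ≡ rootSumTerm m H k a
sumBelow-closedSummand m H k a a≤H a≤k k+H≤m
  with h , refl ← m≤n⇒∃[o]m+o≡n a≤H | κ , refl ← m≤n⇒∃[o]m+o≡n a≤k = begin
  sumBelow (suc m) (closedSummand m (a + h) (a + κ) a)
    ≡⟨ sumBelow-𝟙+≟ (suc m) (λ r → ((m ∸ r) C a) * (r C (a + h ∸ a)))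
                   2a≤ (s≤s (≤-trans (m∸n≤m _ (2 * a)) k+H≤m)) ⟩
  ((m ∸ (a + κ + (a + h) ∸ 2 * a)) C a) * ((a + κ + (a + h) ∸ 2 * a) C (a + h ∸ a))
    ≡⟨ cong₂ (λ x y → ((m ∸ x) C a) * (x C y)) ascentsBelow (m+n∸m≡n a h) ⟩
  ((m ∸ (h + κ)) C a) * ((h + κ) C h)
    ≡⟨ *-comm ((m ∸ (h + κ)) C a) _ ⟩
  ((h + κ) C h) * ((m ∸ (h + κ)) C a)
    ≡⟨ cong₂ (λ x y → ((x + y) C x) * ((m ∸ (h + κ)) C a)) (sym (m+n∸m≡n a h)) (sym (m+n∸m≡n a κ)) ⟩
  ((a + h ∸ a + (a + κ ∸ a)) C (a + h ∸ a)) * ((m ∸ (h + κ)) C a)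
    ≡⟨ cong (λ x → ((a + h ∸ a + (a + κ ∸ a)) C (a + h ∸ a)) * (x C a)) (m∸[h+κ]≡m∸[a+h]∸[a+κ]+2a m a h κ k+H≤m) ⟩
  rootSumTerm m (a + h) (a + κ) a ∎
  where
  open ≡-Reasoning
  regroup : a + κ + (a + h) ≡ h + κ + 2 * a
  regroup = shuffle a h κ
    where shuffle : ∀ a h κ → a + κ + (a + h) ≡ h + κ + 2 * a
          shuffle = solve-∀
  2a≤ : 2 * a ≤ a + κ + (a + h)
  2a≤ = subst (2 * a ≤_) (sym regroup) (m≤n+m (2 * a) (h + κ))
  ascentsBelow : a + κ + (a + h) ∸ 2 * a ≡ h + κ
  ascentsBelow = trans (cong (_∸ 2 * a) regroup) (m+n∸n≡m (h + κ) (2 * a))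

sumBelow-closedSummand-vanish : ∀ m H k a → a ≤ H → k < a → k + H ≤ m →
  sumBelow (suc m) (closedSummand m H k a) ≡ 0
sumBelow-closedSummand-vanish m H k a a≤H k<a k+H≤m with 2 * a ≤? k + H
... | no  2a≰ = sumBelow-𝟙+≟-vanish (suc m) (λ r → ((m ∸ r) C a) * (r C (H ∸ a))) (≰⇒> 2a≰)
... | yes 2a≤ with h , refl ← m≤n⇒∃[o]m+o≡n a≤H = begin
  sumBelow (suc m) (closedSummand m (a + h) k a)
    ≡⟨ sumBelow-𝟙+≟ (suc m) (λ r → ((m ∸ r) C a) * (r C (a + h ∸ a)))
                   2a≤ (s≤s (≤-trans (m∸n≤m _ (2 * a)) k+H≤m)) ⟩
  ((m ∸ (k + (a + h) ∸ 2 * a)) C a) * ((k + (a + h) ∸ 2 * a) C (a + h ∸ a))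
    ≡⟨ cong (((m ∸ (k + (a + h) ∸ 2 * a)) C a) *_) (k>n⇒nCk≡0 tooFewBelow) ⟩
  ((m ∸ (k + (a + h) ∸ 2 * a)) C a) * 0
    ≡⟨ *-zeroʳ ((m ∸ (k + (a + h) ∸ 2 * a)) C a) ⟩
  0 ∎
  where
  open ≡-Reasoning
  tooFewBelow : k + (a + h) ∸ 2 * a < a + h ∸ a
  tooFewBelow = subst (k + (a + h) ∸ 2 * a <_) (trans (m+n∸m≡n (2 * a) h) (sym (m+n∸m≡n a h)))
                      (∸-monoˡ-< (subst (k + (a + h) <_) (double a h) (+-monoˡ-< (a + h) k<a)) 2a≤)
    where double : ∀ a h → a + (a + h) ≡ 2 * a + h
          double = solve-∀

sumBelow-markings : ∀ m H L k → H + L ≡ m → k + H ≤ m →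
  sumBelow (suc m) (λ r → markings (m ∸ r) r H L k) ≡ sumBelow (suc (H ⊓ k)) (rootSumTerm m H k)
sumBelow-markings m H L k H+L≡m k+H≤m = begin
  sumBelow (suc m) (λ r → markings (m ∸ r) r H L k)
    ≡⟨ sumBelow-cong (suc m) (λ r r≤m → markings≡markingsClosed (m ∸ r) r H L k
                                           (trans H+L≡m (sym (m∸n+n≡m (<⇒≤pred r≤m))))) ⟩
  sumBelow (suc m) (λ r → sumBelow (suc H) (λ a → closedSummand m H k a r))
    ≡⟨ sumBelow-swap (suc m) (suc H) (λ r a → closedSummand m H k a r) ⟩
  sumBelow (suc H) (λ a → sumBelow (suc m) (closedSummand m H k a))
    ≡⟨ sumBelow-truncate (suc (H ⊓ k)) (suc H) _ (s≤s (m⊓n≤m H k)) beyondK ⟩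
  sumBelow (suc (H ⊓ k)) (λ a → sumBelow (suc m) (closedSummand m H k a))
    ≡⟨ sumBelow-cong (suc (H ⊓ k)) (λ a a≤H⊓k → sumBelow-closedSummand m H k a
          (≤-trans (<⇒≤pred a≤H⊓k) (m⊓n≤m H k)) (≤-trans (<⇒≤pred a≤H⊓k) (m⊓n≤n H k)) k+H≤m) ⟩
  sumBelow (suc (H ⊓ k)) (rootSumTerm m H k) ∎
  where
  open ≡-Reasoning
  beyondK : ∀ a → suc (H ⊓ k) ≤ a → a < suc H → sumBelow (suc m) (closedSummand m H k a) ≡ 0
  beyondK a H⊓k<a a≤H = sumBelow-closedSummand-vanish m H k a (<⇒≤pred a≤H) k<a k+H≤m
    where k<a : k < a
          k<a = ≰⇒> (λ a≤k → <⇒≱ H⊓k<a (⊓-glb (<⇒≤pred a≤H) a≤k))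

k+min≤m : ∀ {k s t m} → 2 * k ≤ m → s ≤ t → s + t ≡ m → k + s ≤ m
k+min≤m {k} {s} {t} {m} 2k≤m s≤t s+t≡m = *-cancelˡ-≤ 2 (begin
  2 * (k + s)   ≡⟨ *-distribˡ-+ 2 k s ⟩
  2 * k + 2 * s ≤⟨ +-mono-≤ 2k≤m (subst (2 * s ≤_) (trans (+-comm t s) s+t≡m) 2s≤t+s) ⟩
  m + m         ≡⟨ double m ⟩
  2 * m         ∎)
  where
  open ≤-Reasoning
  double : ∀ x → x + x ≡ 2 * x
  double = solve-∀
  2s≤t+s : 2 * s ≤ t + s
  2s≤t+s = subst (_≤ t + s) (double s) (+-monoˡ-≤ s s≤t)

sumBelow-markings-min : ∀ m H L k → H + L ≡ m → 2 * k ≤ m →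
  sumBelow (suc m) (λ r → markings (m ∸ r) r H L k) ≡ sumBelow (suc ((H ⊓ L) ⊓ k)) (rootSumTerm m (H ⊓ L) k)
sumBelow-markings-min m H L k H+L≡m 2k≤m with ≤-total H L
... | inj₁ H≤L rewrite m≤n⇒m⊓n≡m H≤L = sumBelow-markings m H L k H+L≡m (k+min≤m 2k≤m H≤L H+L≡m)
... | inj₂ L≤H rewrite m≥n⇒m⊓n≡n L≤H = begin
  sumBelow (suc m) (λ r → markings (m ∸ r) r H L k)
    ≡⟨ sumBelow-cong (suc m) (λ r r≤m → trans (markings-sym (m ∸ r) r H L k)
          (cong (λ x → markings x (m ∸ r) L H k) (sym (m∸[m∸n]≡n (<⇒≤pred r≤m))))) ⟩
  sumBelow (suc m) (λ r → markings (m ∸ (m ∸ r)) (m ∸ r) L H k)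
    ≡⟨ sumBelow-reverse m (λ r → markings (m ∸ r) r L H k) ⟩
  sumBelow (suc m) (λ r → markings (m ∸ r) r L H k)
    ≡⟨ sumBelow-markings m L H k L+H≡m (k+min≤m 2k≤m L≤H L+H≡m) ⟩
  sumBelow (suc (L ⊓ k)) (rootSumTerm m L k) ∎
  where
  open ≡-Reasoning
  L+H≡m : L + H ≡ m
  L+H≡m = trans (+-comm L H) H+L≡m

-- Colorings of the leaves

+≡⇒≤×≡∸ : ∀ {a x y} → a + x ≡ y → a ≤ y × x ≡ y ∸ a
+≡⇒≤×≡∸ {a} {x} refl = m≤m+n a x , sym (m+n∸m≡n a x)

≤×≡∸⇒+≡ : ∀ {a x y} → a ≤ y → x ≡ y ∸ a → a + x ≡ y
≤×≡∸⇒+≡ a≤y refl = m+[n∸m]≡n a≤y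

module _ {n ℓ : ℕ} where

  colorCount-cons : ∀ (c : Fin ℓ) (g : Fin n → Fin ℓ) j → colorCount (c ∷ᶠ g) j ≡ 𝟙 (c Fin.≟ j) + colorCount g j
  colorCount-cons c g j = countFin-suc n (λ v → (c ∷ᶠ g) v Fin.≟ j)

  content-cons⇔ : ∀ (t : Fin ℓ → ℕ) c (g : Fin n → Fin ℓ) →
    (∀ j → colorCount (c ∷ᶠ g) j ≡ t j) ⇔ (1 ≤ t c × ∀ j → colorCount g j ≡ decrementAt Fin._≟_ t c j)
  content-cons⇔ t c g = mk⇔ to from
    where
    to : (∀ j → colorCount (c ∷ᶠ g) j ≡ t j) → 1 ≤ t c × ∀ j → colorCount g j ≡ decrementAt Fin._≟_ t c j
    to content = subst (_≤ t c) (𝟙-yes (c Fin.≟ c) refl) (proj₁ (split c)) , proj₂ ∘ split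
      where
      split : ∀ j → 𝟙 (c Fin.≟ j) ≤ t j × colorCount g j ≡ decrementAt Fin._≟_ t c j
      split j = +≡⇒≤×≡∸ (trans (sym (colorCount-cons c g j)) (content j))
    from : 1 ≤ t c × (∀ j → colorCount g j ≡ decrementAt Fin._≟_ t c j) → ∀ j → colorCount (c ∷ᶠ g) j ≡ t j
    from (1≤tc , content) j = trans (colorCount-cons c g j) (≤×≡∸⇒+≡ 𝟙≤tj (content j))
      where
      𝟙≤tj : 𝟙 (c Fin.≟ j) ≤ t j
      𝟙≤tj with c Fin.≟ j
      ... | yes refl = 1≤tc
      ... | no  _    = z≤n

aboveCount belowCount : ∀ {m} → (Fin m → Bool) → ℕ
aboveCount {m} above = countFin m (λ v → above v Bool.≟ true)
belowCount {m} above = countFin m (λ v → above v Bool.≟ false)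

markings-count-suc : ∀ {m} (above : Fin (suc m) → Bool) H L k →
  markings (aboveCount above) (belowCount above) H L k
    ≡ markingStep (above zero) (markings (aboveCount (above ∘ suc)) (belowCount (above ∘ suc))) H L k
markings-count-suc {m} above H L k
  rewrite countFin-suc m (λ v → above v Bool.≟ true) | countFin-suc m (λ v → above v Bool.≟ false)
  with above zero
... | true  = refl
... | false = markings-suc-below (aboveCount (above ∘ suc)) (belowCount (above ∘ suc)) H L k

module LeafColorings {ℓ : ℕ} (i : Fin ℓ) where

  High Low : Fin ℓ → Set
  High c = toℕ i < toℕ c
  Low  c = toℕ c < toℕ i

  high? : ∀ c → Dec (High c)
  high? c = toℕ i <? toℕ c

  low? : ∀ c → Dec (Low c)
  low? c = toℕ c <? toℕ i

  Ascends : Bool → Fin ℓ → Set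
  Ascends true  = High
  Ascends false = Low

  ascends? : ∀ above c → Dec (Ascends above c)
  ascends? true  = high?
  ascends? false = low?

  ascends⇔ : ∀ {a b} (d : Dec (a < b)) → a ≢ b → ∀ c → ((a < b × High c) ⊎ (b < a × Low c)) ⇔ Ascends (does d) c
  ascends⇔ (yes a<b) a≢b c = mk⇔ (λ { (inj₁ (_ , i<c)) → i<c ; (inj₂ (b<a , _)) → ⊥-elim (<-asym a<b b<a) })
                                 (λ i<c → inj₁ (a<b , i<c))
  ascends⇔ (no  a≮b) a≢b c = mk⇔ (λ { (inj₁ (a<b , _)) → ⊥-elim (a≮b a<b) ; (inj₂ (_ , c<i)) → c<i })
                                 (λ c<i → inj₂ (≤∧≢⇒< (≮⇒≥ a≮b) (a≢b ∘ sym) , c<i))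

  ascents : ∀ {m} → (Fin m → Bool) → (Fin m → Fin ℓ) → ℕ
  ascents {m} above g = countFin m (λ v → ascends? (above v) (g v))

  LeafColoring : ∀ {m} → (Fin m → Bool) → (Fin ℓ → ℕ) → ℕ → (Fin m → Fin ℓ) → Set
  LeafColoring above t k g = (∀ j → colorCount g j ≡ t j) × ascents above g ≡ k

  leafColoring? : ∀ {m} (above : Fin m → Bool) t k g → Dec (LeafColoring above t k g)
  leafColoring? above t k g = Fin.all? (λ j → colorCount g j ≟ t j) ×-dec (ascents above g ≟ k)

  leafColorings : (m : ℕ) → (Fin m → Bool) → (Fin ℓ → ℕ) → ℕ → ℕ
  leafColorings m above t k = countFuns m ℓ (leafColoring? above t k)

  highColors lowColors : List (Fin ℓ)
  highColors = filter high? (allFin ℓ)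
  lowColors  = filter low? (allFin ℓ)

  highTotal lowTotal highMultinomial lowMultinomial : (Fin ℓ → ℕ) → ℕ
  highTotal t       = sum (map t highColors)
  lowTotal t        = sum (map t lowColors)
  highMultinomial t = multinomial (map t highColors)
  lowMultinomial t  = multinomial (map t lowColors)

  leafFormula : ∀ {m} → (Fin m → Bool) → (Fin ℓ → ℕ) → ℕ → ℕ
  leafFormula above t k =
    highMultinomial t * lowMultinomial t
      * markings (aboveCount above) (belowCount above) (highTotal t) (lowTotal t) k

  module _ {m : ℕ} (above : Fin m → Bool) where

    LeafColoring-resp : ∀ t k → LeafColoring above t k Respects _≗_
    LeafColoring-resp t k {g} {h} g≗h (content , asc) =
      (λ j → trans (countFin-cong m (λ v → h v Fin.≟ j) (λ v → g v Fin.≟ j) (λ {v} → trans (g≗h v))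
                                                                           (λ {v} → trans (sym (g≗h v))))
                   (content j)) ,
      trans (countFin-cong m (λ v → ascends? (above v) (h v)) (λ v → ascends? (above v) (g v))
                             (λ {v} → subst (Ascends (above v)) (sym (g≗h v)))
                             (λ {v} → subst (Ascends (above v)) (g≗h v)))
            asc

  module _ {m : ℕ} (above : Fin (suc m) → Bool) where

    firstAscent : Fin ℓ → ℕ
    firstAscent c = 𝟙 (ascends? (above zero) c)

    ascents-cons : ∀ c (g : Fin m → Fin ℓ) → ascents above (c ∷ᶠ g) ≡ firstAscent c + ascents (above ∘ suc) g
    ascents-cons c g = countFin-suc m (λ v → ascends? (above v) ((c ∷ᶠ g) v))

    leafColoring-cons⇔ : ∀ t k c (g : Fin m → Fin ℓ) →
      LeafColoring above t k (c ∷ᶠ g)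
        ⇔ ((1 ≤ t c × firstAscent c ≤ k) × LeafColoring (above ∘ suc) (decrementAt Fin._≟_ t c) (k ∸ firstAscent c) g)
    leafColoring-cons⇔ t k c g = mk⇔ to from
      where
      to : LeafColoring above t k (c ∷ᶠ g) →
           (1 ≤ t c × firstAscent c ≤ k) × LeafColoring (above ∘ suc) (decrementAt Fin._≟_ t c) (k ∸ firstAscent c) g
      to (content , asc) with Equivalence.to (content-cons⇔ t c g) content
                            | +≡⇒≤×≡∸ (trans (sym (ascents-cons c g)) asc)
      ... | 1≤tc , content′ | δ≤k , asc′ = (1≤tc , δ≤k) , (content′ , asc′)
      from : (1 ≤ t c × firstAscent c ≤ k) × LeafColoring (above ∘ suc) (decrementAt Fin._≟_ t c) (k ∸ firstAscent c) g →
             LeafColoring above t k (c ∷ᶠ g)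
      from ((1≤tc , δ≤k) , (content′ , asc′)) =
        Equivalence.from (content-cons⇔ t c g) (1≤tc , content′) , trans (ascents-cons c g) (≤×≡∸⇒+≡ δ≤k asc′)

    leafColorings-suc : ∀ t k → leafColorings (suc m) above t k ≡
      ΣFin ℓ (λ c → 𝟙 (1 ≤? t c) * 𝟙 (firstAscent c ≤? k)
                      * leafColorings m (above ∘ suc) (decrementAt Fin._≟_ t c) (k ∸ firstAscent c))
    leafColorings-suc t k = trans (countFuns-suc (leafColoring? above t k) (LeafColoring-resp above t k))
      (sumMap-cong (allFin ℓ) λ c → begin
        countFuns m ℓ (λ g → leafColoring? above t k (c ∷ᶠ g))
          ≡⟨ countFuns-cong _ (λ g → ((1 ≤? t c) ×-dec (firstAscent c ≤? k)) ×-dec rest? c g)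
                            (Equivalence.to (leafColoring-cons⇔ t k c _)) (Equivalence.from (leafColoring-cons⇔ t k c _)) ⟩
        countFuns m ℓ (λ g → ((1 ≤? t c) ×-dec (firstAscent c ≤? k)) ×-dec rest? c g)
          ≡⟨ countFuns-const× ((1 ≤? t c) ×-dec (firstAscent c ≤? k)) (rest? c) ⟩
        𝟙 ((1 ≤? t c) ×-dec (firstAscent c ≤? k)) * countFuns m ℓ (rest? c)
          ≡⟨ cong (_* countFuns m ℓ (rest? c)) (𝟙-× (1 ≤? t c) (firstAscent c ≤? k)) ⟩
        𝟙 (1 ≤? t c) * 𝟙 (firstAscent c ≤? k) * countFuns m ℓ (rest? c) ∎)
      where
      open ≡-Reasoning
      rest? : ∀ c g → Dec (LeafColoring (above ∘ suc) (decrementAt Fin._≟_ t c) (k ∸ firstAscent c) g)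
      rest? c = leafColoring? (above ∘ suc) (decrementAt Fin._≟_ t c) (k ∸ firstAscent c)

  ΣFin-highLow : ∀ (f : Fin ℓ → ℕ) → f i ≡ 0 → ΣFin ℓ f ≡ sumMap highColors f + sumMap lowColors f
  ΣFin-highLow f fi≡0 = begin
    ΣFin ℓ f
      ≡⟨ sumMap-cong (allFin ℓ) byPosition ⟩
    sumMap (allFin ℓ) (λ c → 𝟙 (high? c) * f c + 𝟙 (low? c) * f c)
      ≡⟨ sumMap-+ (allFin ℓ) _ _ ⟩
    sumMap (allFin ℓ) (λ c → 𝟙 (high? c) * f c) + sumMap (allFin ℓ) (λ c → 𝟙 (low? c) * f c)
      ≡⟨ cong₂ _+_ (sumMap-filter high? (allFin ℓ) f) (sumMap-filter low? (allFin ℓ) f) ⟨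
    sumMap highColors f + sumMap lowColors f                                     ∎
    where
    open ≡-Reasoning
    byPosition : ∀ c → f c ≡ 𝟙 (high? c) * f c + 𝟙 (low? c) * f c
    byPosition c with <-cmp (toℕ i) (toℕ c)
    ... | tri< i<c _ c≮i = sym (begin
      𝟙 (high? c) * f c + 𝟙 (low? c) * f c
        ≡⟨ cong₂ (λ a b → a * f c + b * f c) (𝟙-yes (high? c) i<c) (𝟙-no (low? c) c≮i) ⟩
      1 * f c + 0 * f c
        ≡⟨ trans (+-identityʳ (1 * f c)) (*-identityˡ (f c)) ⟩
      f c                                   ∎)
    ... | tri> i≮c _ c<i = sym (begin
      𝟙 (high? c) * f c + 𝟙 (low? c) * f c
        ≡⟨ cong₂ (λ a b → a * f c + b * f c) (𝟙-no (high? c) i≮c) (𝟙-yes (low? c) c<i) ⟩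
      0 * f c + 1 * f c
        ≡⟨ *-identityˡ (f c) ⟩
      f c                                   ∎)
    ... | tri≈ i≮c i≡c c≮i = begin
      f c
        ≡⟨ trans (cong f (Fin.toℕ-injective (sym i≡c))) fi≡0 ⟩
      0 * f c + 0 * f c
        ≡⟨ cong₂ (λ a b → a * f c + b * f c) (𝟙-no (high? c) i≮c) (𝟙-no (low? c) c≮i) ⟨
      𝟙 (high? c) * f c + 𝟙 (low? c) * f c ∎

  high∉lowColors : ∀ {c} → High c → All.All (c ≢_) lowColors
  high∉lowColors i<c = All.map (λ c<i c≡ → <-asym i<c (subst Low (sym c≡) c<i)) (all-filter low? (allFin ℓ))

  low∉highColors : ∀ {c} → Low c → All.All (c ≢_) highColors
  low∉highColors c<i = All.map (λ i<c c≡ → <-asym c<i (subst High (sym c≡) i<c)) (all-filter high? (allFin ℓ))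

  𝟙-ascends-high : ∀ above {c} → High c → 𝟙 (ascends? above c) ≡ ascentIfHigh above
  𝟙-ascends-high true  i<c = 𝟙-yes (high? _) i<c
  𝟙-ascends-high false i<c = 𝟙-no (low? _) (<-asym i<c)

  𝟙-ascends-low : ∀ above {c} → Low c → 𝟙 (ascends? above c) ≡ ascentIfLow above
  𝟙-ascends-low true  c<i = 𝟙-no (high? _) (<-asym c<i)
  𝟙-ascends-low false c<i = 𝟙-yes (low? _) c<i

  decrementAt-i : ∀ t c → t i ≡ 0 → decrementAt Fin._≟_ t c i ≡ 0
  decrementAt-i t c ti≡0 = trans (cong (_∸ 𝟙 (c Fin.≟ i)) ti≡0) (0∸n≡0 (𝟙 (c Fin.≟ i)))

  highColors-unique : Unique highColors
  highColors-unique = Unique.filter⁺ high? (Unique.allFin⁺ ℓ)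

  lowColors-unique : Unique lowColors
  lowColors-unique = Unique.filter⁺ low? (Unique.allFin⁺ ℓ)

  module FirstLeaf {m : ℕ} (above : Fin (suc m) → Bool) (t : Fin ℓ → ℕ) (k : ℕ) where

    rest : Fin m → Bool
    rest = above ∘ suc

    H L MH ML : ℕ
    H  = highTotal t
    L  = lowTotal t
    MH = highMultinomial t
    ML = lowMultinomial t

    aH aL : ℕ
    aH = ascentIfHigh (above zero)
    aL = ascentIfLow (above zero)

    markingsRest : ℕ → ℕ → ℕ → ℕ
    markingsRest = markings (aboveCount rest) (belowCount rest)

    firstColorTerm : Fin ℓ → ℕ
    firstColorTerm c = 𝟙 (1 ≤? t c) * 𝟙 (firstAscent above c ≤? k)
                       * leafFormula rest (decrementAt Fin._≟_ t c) (k ∸ firstAscent above c)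

    highWeight lowWeight : ℕ
    highWeight = 𝟙 (aH ≤? k) * ML * markingsRest (H ∸ 1) L (k ∸ aH)
    lowWeight  = 𝟙 (aL ≤? k) * MH * markingsRest H (L ∸ 1) (k ∸ aL)

    firstColorTerm≡0 : ∀ c → t c ≡ 0 → firstColorTerm c ≡ 0
    firstColorTerm≡0 c tc≡0 =
      cong (λ x → 𝟙 (1 ≤? x) * 𝟙 (firstAscent above c ≤? k)
                    * leafFormula rest (decrementAt Fin._≟_ t c) (k ∸ firstAscent above c))
           tc≡0

    highTerm : ∀ c → c ∈ highColors →
      firstColorTerm c ≡ highWeight * (𝟙 (1 ≤? t c) * multinomial (map (decrementAt Fin._≟_ t c) highColors))
    highTerm c c∈high = begin
      shape (firstAscent above c) (map tc lowColors)
        ≡⟨ cong₂ shape (𝟙-ascends-high (above zero) i<c) (map-decrementAt-∉ Fin._≟_ t c (high∉lowColors i<c)) ⟩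
      shape aH (map t lowColors)
        ≡⟨ regroup (𝟙 (1 ≤? t c)) (𝟙 (aH ≤? k)) MHc ML (markingsRest Hc L (k ∸ aH)) ⟩
      𝟙 (1 ≤? t c) * (MHc * (𝟙 (aH ≤? k) * ML * markingsRest Hc L (k ∸ aH)))
        ≡⟨ 𝟙-*-cong (1 ≤? t c) (λ 1≤tc → cong (λ h → MHc * (𝟙 (aH ≤? k) * ML * markingsRest h L (k ∸ aH)))
                                               (cong pred (suc-sum-decrementAt Fin._≟_ t highColors-unique c∈high 1≤tc))) ⟩
      𝟙 (1 ≤? t c) * (MHc * highWeight)
        ≡⟨ rotate (𝟙 (1 ≤? t c)) MHc highWeight ⟩
      highWeight * (𝟙 (1 ≤? t c) * MHc) ∎
      where
      open ≡-Reasoning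
      i<c : High c
      i<c = proj₂ (∈-filter⁻ high? {xs = allFin ℓ} c∈high)
      tc : Fin ℓ → ℕ
      tc = decrementAt Fin._≟_ t c
      MHc Hc : ℕ
      MHc = multinomial (map tc highColors)
      Hc = sum (map tc highColors)
      shape : ℕ → List ℕ → ℕ
      shape δ ls = 𝟙 (1 ≤? t c) * 𝟙 (δ ≤? k) * (MHc * multinomial ls * markingsRest Hc (sum ls) (k ∸ δ))
      regroup : ∀ p q M N P → p * q * (M * N * P) ≡ p * (M * (q * N * P))
      regroup = solve-∀
      rotate : ∀ p M W → p * (M * W) ≡ W * (p * M)
      rotate = solve-∀

    lowTerm : ∀ c → c ∈ lowColors →
      firstColorTerm c ≡ lowWeight * (𝟙 (1 ≤? t c) * multinomial (map (decrementAt Fin._≟_ t c) lowColors))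
    lowTerm c c∈low = begin
      shape (firstAscent above c) (map tc highColors)
        ≡⟨ cong₂ shape (𝟙-ascends-low (above zero) c<i) (map-decrementAt-∉ Fin._≟_ t c (low∉highColors c<i)) ⟩
      shape aL (map t highColors)
        ≡⟨ regroup (𝟙 (1 ≤? t c)) (𝟙 (aL ≤? k)) MH MLc (markingsRest H Lc (k ∸ aL)) ⟩
      𝟙 (1 ≤? t c) * (MLc * (𝟙 (aL ≤? k) * MH * markingsRest H Lc (k ∸ aL)))
        ≡⟨ 𝟙-*-cong (1 ≤? t c) (λ 1≤tc → cong (λ l → MLc * (𝟙 (aL ≤? k) * MH * markingsRest H l (k ∸ aL)))
                                               (cong pred (suc-sum-decrementAt Fin._≟_ t lowColors-unique c∈low 1≤tc))) ⟩
      𝟙 (1 ≤? t c) * (MLc * lowWeight)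
        ≡⟨ rotate (𝟙 (1 ≤? t c)) MLc lowWeight ⟩
      lowWeight * (𝟙 (1 ≤? t c) * MLc) ∎
      where
      open ≡-Reasoning
      c<i : Low c
      c<i = proj₂ (∈-filter⁻ low? {xs = allFin ℓ} c∈low)
      tc : Fin ℓ → ℕ
      tc = decrementAt Fin._≟_ t c
      MLc Lc : ℕ
      MLc = multinomial (map tc lowColors)
      Lc = sum (map tc lowColors)
      shape : ℕ → List ℕ → ℕ
      shape δ hs = 𝟙 (1 ≤? t c) * 𝟙 (δ ≤? k) * (multinomial hs * MLc * markingsRest (sum hs) Lc (k ∸ δ))
      regroup : ∀ p q M N P → p * q * (M * N * P) ≡ p * (N * (q * M * P))
      regroup = solve-∀
      rotate : ∀ p M W → p * (M * W) ≡ W * (p * M)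
      rotate = solve-∀

    highPart : sumMap highColors firstColorTerm ≡ highWeight * (𝟙 (1 ≤? H) * MH)
    highPart = begin
      sumMap highColors firstColorTerm
        ≡⟨ sumMap-cong∈ highColors highTerm ⟩
      sumMap highColors (λ c → highWeight * (𝟙 (1 ≤? t c) * multinomial (map (decrementAt Fin._≟_ t c) highColors)))
        ≡⟨ *-distribˡ-sumMap highColors highWeight _ ⟩
      highWeight * sumMap highColors (λ c → 𝟙 (1 ≤? t c) * multinomial (map (decrementAt Fin._≟_ t c) highColors))
        ≡⟨ cong (highWeight *_) (multinomial-pascal Fin._≟_ t highColors-unique) ⟩
      highWeight * (𝟙 (1 ≤? H) * MH) ∎
      where open ≡-Reasoning

    lowPart : sumMap lowColors firstColorTerm ≡ lowWeight * (𝟙 (1 ≤? L) * ML)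
    lowPart = begin
      sumMap lowColors firstColorTerm
        ≡⟨ sumMap-cong∈ lowColors lowTerm ⟩
      sumMap lowColors (λ c → lowWeight * (𝟙 (1 ≤? t c) * multinomial (map (decrementAt Fin._≟_ t c) lowColors)))
        ≡⟨ *-distribˡ-sumMap lowColors lowWeight _ ⟩
      lowWeight * sumMap lowColors (λ c → 𝟙 (1 ≤? t c) * multinomial (map (decrementAt Fin._≟_ t c) lowColors))
        ≡⟨ cong (lowWeight *_) (multinomial-pascal Fin._≟_ t lowColors-unique) ⟩
      lowWeight * (𝟙 (1 ≤? L) * ML) ∎
      where open ≡-Reasoning

    ΣFin-firstColorTerm : t i ≡ 0 → ΣFin ℓ firstColorTerm ≡ MH * ML * markingStep (above zero) markingsRest H L k
    ΣFin-firstColorTerm ti≡0 = begin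
      ΣFin ℓ firstColorTerm
        ≡⟨ ΣFin-highLow firstColorTerm (firstColorTerm≡0 i ti≡0) ⟩
      sumMap highColors firstColorTerm + sumMap lowColors firstColorTerm
        ≡⟨ cong₂ _+_ highPart lowPart ⟩
      highWeight * (𝟙 (1 ≤? H) * MH) + lowWeight * (𝟙 (1 ≤? L) * ML)
        ≡⟨ collect (𝟙 (aH ≤? k)) (𝟙 (aL ≤? k)) ML MH (markingsRest (H ∸ 1) L (k ∸ aH)) (markingsRest H (L ∸ 1) (k ∸ aL))
                   (𝟙 (1 ≤? H)) (𝟙 (1 ≤? L)) ⟩
      MH * ML * markingStep (above zero) markingsRest H L k ∎
      where
      open ≡-Reasoning
      collect : ∀ qH qL ML MH PH PL pH pL →
        qH * ML * PH * (pH * MH) + qL * MH * PL * (pL * ML) ≡ MH * ML * (pH * qH * PH + pL * qL * PL)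
      collect = solve-∀

  noLeaves⇔ : ∀ (above : Fin 0 → Bool) t k g → t i ≡ 0 →
    LeafColoring above t k g ⇔ ((highTotal t ≡ 0 × lowTotal t ≡ 0) × k ≡ 0)
  noLeaves⇔ above t k g ti≡0 = mk⇔
    (λ (content , 0≡k) → (sumMap-zero highColors (sym ∘ content) , sumMap-zero lowColors (sym ∘ content)) , sym 0≡k)
    (λ ((H≡0 , L≡0) , k≡0) →
       (λ j → sym (sumMap≡0⇒∈≡0 t (trans (ΣFin-highLow t ti≡0) (cong₂ _+_ H≡0 L≡0)) (∈-allFin j))) , sym k≡0)

  leafColorings-zero : ∀ (above : Fin 0 → Bool) t k → t i ≡ 0 → leafColorings 0 above t k ≡ leafFormula above t k
  leafColorings-zero above t k ti≡0 = begin
    leafColorings 0 above t k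
      ≡⟨ countFuns-cong {0} {ℓ} (leafColoring? above t k) (λ _ → empty?)
                        (λ {g} → Equivalence.to (noLeaves⇔ above t k g ti≡0))
                        (λ {g} → Equivalence.from (noLeaves⇔ above t k g ti≡0)) ⟩
    countFuns 0 ℓ (λ _ → empty?)
      ≡⟨ countFuns-zero-const empty? ⟩
    𝟙 empty?
      ≡⟨ trans (𝟙-× (H≟0 ×-dec L≟0) (k ≟ 0)) (cong (_* 𝟙 (k ≟ 0)) (𝟙-× H≟0 L≟0)) ⟩
    𝟙 H≟0 * 𝟙 L≟0 * 𝟙 (k ≟ 0)
      ≡⟨ cong₂ (λ x y → x * y * 𝟙 (k ≟ 0)) (𝟙*multinomial (map t highColors)) (𝟙*multinomial (map t lowColors)) ⟨
    𝟙 H≟0 * highMultinomial t * (𝟙 L≟0 * lowMultinomial t) * 𝟙 (k ≟ 0)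
      ≡⟨ regroup (𝟙 H≟0) (highMultinomial t) (𝟙 L≟0) (lowMultinomial t) (𝟙 (k ≟ 0)) ⟩
    leafFormula above t k ∎
    where
    open ≡-Reasoning
    H≟0 : Dec (highTotal t ≡ 0)
    H≟0 = highTotal t ≟ 0
    L≟0 : Dec (lowTotal t ≡ 0)
    L≟0 = lowTotal t ≟ 0
    empty? : Dec ((highTotal t ≡ 0 × lowTotal t ≡ 0) × k ≡ 0)
    empty? = (H≟0 ×-dec L≟0) ×-dec (k ≟ 0)
    regroup : ∀ h M l N z → h * M * (l * N) * z ≡ M * N * (h * l * z)
    regroup = solve-∀

  leafColorings≡leafFormula : ∀ m (above : Fin m → Bool) t k → t i ≡ 0 →
    leafColorings m above t k ≡ leafFormula above t k
  leafColorings≡leafFormula zero    above t k ti≡0 = leafColorings-zero above t k ti≡0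
  leafColorings≡leafFormula (suc m) above t k ti≡0 = begin
    leafColorings (suc m) above t k
      ≡⟨ leafColorings-suc above t k ⟩
    ΣFin ℓ (λ c → 𝟙 (1 ≤? t c) * 𝟙 (firstAscent above c ≤? k)
                    * leafColorings m rest (decrementAt Fin._≟_ t c) (k ∸ firstAscent above c))
      ≡⟨ sumMap-cong (allFin ℓ) (λ c → cong (𝟙 (1 ≤? t c) * 𝟙 (firstAscent above c ≤? k) *_)
           (leafColorings≡leafFormula m rest (decrementAt Fin._≟_ t c) (k ∸ firstAscent above c) (decrementAt-i t c ti≡0))) ⟩
    ΣFin ℓ firstColorTerm
      ≡⟨ ΣFin-firstColorTerm ti≡0 ⟩
    MH * ML * markingStep (above zero) markingsRest H L k
      ≡⟨ cong (MH * ML *_) (markings-count-suc above H L k) ⟨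
    leafFormula above t k ∎
    where
    open ≡-Reasoning
    open FirstLeaf above t k

-- Labelings and the root color

⟨$⟩ʳ-injective : ∀ {n} (π : Permutation′ n) {a b} → π ⟨$⟩ʳ a ≡ π ⟨$⟩ʳ b → a ≡ b
⟨$⟩ʳ-injective π {a} {b} πa≡πb = trans (sym (inverseˡ π)) (trans (cong (π ⟨$⟩ˡ_) πa≡πb) (inverseˡ π))

does<-false⇔ : ∀ {a b} (d : Dec (a < b)) → a ≢ b → (does d ≡ false) ⇔ (b < a)
does<-false⇔ (yes a<b) a≢b = mk⇔ (λ ()) (λ b<a → ⊥-elim (<-asym a<b b<a))
does<-false⇔ (no  a≮b) a≢b = mk⇔ (λ _ → ≤∧≢⇒< (≮⇒≥ a≮b) (a≢b ∘ sym)) (λ _ → refl)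

module Labeling {m : ℕ} (π : Permutation′ (suc m)) where

  rootLabel : ℕ
  rootLabel = toℕ (π ⟨$⟩ʳ zero)

  leafLabel : Fin m → ℕ
  leafLabel v = toℕ (π ⟨$⟩ʳ suc v)

  aboveRoot : Fin m → Bool
  aboveRoot v = does (rootLabel <? leafLabel v)

  rootLabel≢leafLabel : ∀ v → rootLabel ≢ leafLabel v
  rootLabel≢leafLabel v root≡leaf with ⟨$⟩ʳ-injective π (Fin.toℕ-injective root≡leaf)
  ... | ()

  belowCount-aboveRoot : belowCount aboveRoot ≡ rootLabel
  belowCount-aboveRoot = begin
    countFin m (λ v → aboveRoot v Bool.≟ false)
      ≡⟨ countFin-cong m _ (λ v → leafLabel v <? rootLabel) (Equivalence.to (below⇔ _)) (Equivalence.from (below⇔ _)) ⟩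
    countFin m (λ v → leafLabel v <? rootLabel)
      ≡⟨ cong (_+ countFin m (λ v → leafLabel v <? rootLabel)) (𝟙-no (rootLabel <? rootLabel) (<-irrefl refl)) ⟨
    𝟙 (rootLabel <? rootLabel) + countFin m (λ v → leafLabel v <? rootLabel)
      ≡⟨ countFin-suc m (λ w → toℕ (π ⟨$⟩ʳ w) <? rootLabel) ⟨
    countFin (suc m) (λ w → toℕ (π ⟨$⟩ʳ w) <? rootLabel)
      ≡⟨ countFin-permute (suc m) (λ u → toℕ u <? rootLabel) π ⟩
    countFin (suc m) (λ u → toℕ u <? rootLabel)
      ≡⟨ countFin-toℕ< (suc m) rootLabel (<⇒≤ (Fin.toℕ<n (π ⟨$⟩ʳ zero))) ⟩
    rootLabel ∎
    where
    open ≡-Reasoning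
    below⇔ : ∀ v → (aboveRoot v ≡ false) ⇔ (leafLabel v < rootLabel)
    below⇔ v = does<-false⇔ (rootLabel <? leafLabel v) (rootLabel≢leafLabel v)

  aboveCount-aboveRoot : aboveCount aboveRoot ≡ m ∸ rootLabel
  aboveCount-aboveRoot = begin
    aboveCount aboveRoot
      ≡⟨ m+n∸n≡m (aboveCount aboveRoot) (belowCount aboveRoot) ⟨
    aboveCount aboveRoot + belowCount aboveRoot ∸ belowCount aboveRoot
      ≡⟨ cong₂ _∸_ (countFin-true+false m aboveRoot) belowCount-aboveRoot ⟩
    m ∸ rootLabel                                                  ∎
    where open ≡-Reasoning

module RootColor (α : List ℕ) (i : Fin (length α)) (αᵢ≡1 : lookup α i ≡ 1) where

  open LeafColorings i

  leafContent : Fin (length α) → ℕ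
  leafContent = decrementAt Fin._≟_ (lookup α) i

  leafContent-i : leafContent i ≡ 0
  leafContent-i = trans (decrementAt-self Fin._≟_ (lookup α) i) (cong (_∸ 1) αᵢ≡1)

  H L : ℕ
  H = highTotal leafContent
  L = lowTotal leafContent

  module _ {m : ℕ} (π : Permutation′ (suc m)) (k : ℕ) where

    open Labeling π

    asc≡ascents : ∀ (g : Fin m → Fin (length α)) → asc π (i ∷ᶠ g) ≡ ascents aboveRoot g
    asc≡ascents g = countFin-cong m (isAscent? π (i ∷ᶠ g)) (λ v → ascends? (aboveRoot v) (g v))
      (λ {v} → Equivalence.to (isAscent⇔ v)) (λ {v} → Equivalence.from (isAscent⇔ v))
      where
      isAscent⇔ : ∀ v → IsAscent π (i ∷ᶠ g) v ⇔ Ascends (aboveRoot v) (g v)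
      isAscent⇔ v = ascends⇔ (rootLabel <? leafLabel v) (rootLabel≢leafLabel v) (g v)

    counted-cons⇔ : ∀ c (g : Fin m → Fin (length α)) →
      Counted α i π k (c ∷ᶠ g) ⇔ (c ≡ i × LeafColoring aboveRoot leafContent k g)
    counted-cons⇔ c g = mk⇔ to from
      where
      to : Counted α i π k (c ∷ᶠ g) → c ≡ i × LeafColoring aboveRoot leafContent k g
      to (_ , content , refl , asc≡k) =
        refl , proj₂ (Equivalence.to (content-cons⇔ (lookup α) i g) content) , trans (sym (asc≡ascents g)) asc≡k
      from : c ≡ i × LeafColoring aboveRoot leafContent k g → Counted α i π k (c ∷ᶠ g)
      from (refl , content , ascents≡k) =
        (λ v → countFin≡0⇒¬ m (λ v → g v Fin.≟ i) (trans (content i) leafContent-i) v) ,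
        Equivalence.from (content-cons⇔ (lookup α) i g) (subst (1 ≤_) (sym αᵢ≡1) ≤-refl , content) ,
        refl ,
        trans (asc≡ascents g) ascents≡k

    Counted-resp : Counted α i π k Respects _≗_
    Counted-resp {κ} {κ′} κ≗κ′ (proper , content , root , asc≡k) =
      (λ v κ′v≡κ′0 → proper v (trans (κ≗κ′ (suc v)) (trans κ′v≡κ′0 (sym (κ≗κ′ zero))))) ,
      (λ j → trans (countFin-cong (suc m) (λ v → κ′ v Fin.≟ j) (λ v → κ v Fin.≟ j)
                                  (λ {v} → trans (κ≗κ′ v)) (λ {v} → trans (sym (κ≗κ′ v))))
                   (content j)) ,
      trans (sym (κ≗κ′ zero)) root ,
      trans (countFin-cong m (isAscent? π κ′) (isAscent? π κ)
                           (λ {v} → subst₂ (ascentAt v) (sym (κ≗κ′ zero)) (sym (κ≗κ′ (suc v))))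
                           (λ {v} → subst₂ (ascentAt v) (κ≗κ′ zero) (κ≗κ′ (suc v))))
            asc≡k
      where
      ascentAt : Fin m → Fin (length α) → Fin (length α) → Set
      ascentAt v r c = (rootLabel < leafLabel v × toℕ r < toℕ c) ⊎ (leafLabel v < rootLabel × toℕ c < toℕ r)

    countedColorings≡leafColorings :
      countFuns (suc m) (length α) (counted? α i π k) ≡ leafColorings m aboveRoot leafContent k
    countedColorings≡leafColorings = begin
      countFuns (suc m) (length α) (counted? α i π k)
        ≡⟨ countFuns-suc (counted? α i π k) Counted-resp ⟩
      ΣFin (length α) (λ c → countFuns m (length α) (λ g → counted? α i π k (c ∷ᶠ g)))
        ≡⟨ sumMap-cong (allFin (length α)) (λ c → begin
             countFuns m (length α) (λ g → counted? α i π k (c ∷ᶠ g))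
               ≡⟨ countFuns-cong _ (λ g → (c Fin.≟ i) ×-dec leafColoring? aboveRoot leafContent k g)
                                 (Equivalence.to (counted-cons⇔ c _)) (Equivalence.from (counted-cons⇔ c _)) ⟩
             countFuns m (length α) (λ g → (c Fin.≟ i) ×-dec leafColoring? aboveRoot leafContent k g)
               ≡⟨ countFuns-const× (c Fin.≟ i) (leafColoring? aboveRoot leafContent k) ⟩
             𝟙 (c Fin.≟ i) * leafColorings m aboveRoot leafContent k ∎) ⟩
      ΣFin (length α) (λ c → 𝟙 (c Fin.≟ i) * leafColorings m aboveRoot leafContent k)
        ≡⟨ ΣFin-𝟙≟ (length α) i (λ _ → leafColorings m aboveRoot leafContent k) ⟩
      leafColorings m aboveRoot leafContent k ∎
      where open ≡-Reasoning

  map-leafContent-high : map leafContent highColors ≡ rcomp α i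
  map-leafContent-high = trans
    (map-decrementAt-∉ Fin._≟_ (lookup α) i
       (All.map (λ i<c i≡c → <-irrefl (cong toℕ i≡c) i<c) (all-filter high? (allFin (length α)))))
    (map-lookup-filter-> α i)

  map-leafContent-low : map leafContent lowColors ≡ lcomp α i
  map-leafContent-low = trans
    (map-decrementAt-∉ Fin._≟_ (lookup α) i
       (All.map (λ c<i i≡c → <-irrefl (cong toℕ (sym i≡c)) c<i) (all-filter low? (allFin (length α)))))
    (map-lookup-filter-< α i)

  H+L≡m : ∀ m → sum α ≡ suc m → H + L ≡ m
  H+L≡m m sum≡ = suc-injective (begin
    suc (H + L)
      ≡⟨ cong₂ (λ r l → suc (r + l)) (cong sum map-leafContent-high) (cong sum map-leafContent-low) ⟩
    suc (Rsum α i + Lsum α i)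
      ≡⟨ reorder (Rsum α i) (Lsum α i) ⟩
    Lsum α i + 1 + Rsum α i
      ≡⟨ cong (λ a → Lsum α i + a + Rsum α i) αᵢ≡1 ⟨
    Lsum α i + lookup α i + Rsum α i
      ≡⟨ sum-take-lookup-drop α i ⟩
    sum α
      ≡⟨ sum≡ ⟩
    suc m                                              ∎)
    where
    open ≡-Reasoning
    reorder : ∀ r l → suc (r + l) ≡ l + 1 + r
    reorder = solve-∀

  rhsAt≡ : ∀ m k → rhsAt (suc m) α i k ≡ highMultinomial leafContent * lowMultinomial leafContent
                                            * sumBelow (suc ((H ⊓ L) ⊓ k)) (rootSumTerm m (H ⊓ L) k)
  rhsAt≡ m k = begin
    mult (rcomp α i) * mult (lcomp α i) * innerSum (suc m) (Rsum α i ⊓ Lsum α i) k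
      ≡⟨ cong (mult (rcomp α i) * mult (lcomp α i) *_) (sum-map-applyUpTo (suc ((Rsum α i ⊓ Lsum α i) ⊓ k)) _ (λ j → j)) ⟩
      -- the `_` is the summand of innerSum, which is rootSumTerm m because suc m ∸ 1 reduces to m
    mult (rcomp α i) * mult (lcomp α i) * sumBelow (suc ((Rsum α i ⊓ Lsum α i) ⊓ k)) (rootSumTerm m (Rsum α i ⊓ Lsum α i) k)
      ≡⟨ cong₂ (λ x s → x * sumBelow (suc (s ⊓ k)) (rootSumTerm m s k))
               (cong₂ _*_ (trans (mult≡multinomial (rcomp α i)) (cong multinomial (sym map-leafContent-high)))
                          (trans (mult≡multinomial (lcomp α i)) (cong multinomial (sym map-leafContent-low))))
               (cong₂ _⊓_ (cong sum (sym map-leafContent-high)) (cong sum (sym map-leafContent-low))) ⟩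
    highMultinomial leafContent * lowMultinomial leafContent * sumBelow (suc ((H ⊓ L) ⊓ k)) (rootSumTerm m (H ⊓ L) k) ∎
    where open ≡-Reasoning

  bCoeffAt≡rhsAt : ∀ m → IsComposition (suc m) α → (Ls : Fin (suc m) → Permutation′ (suc m)) → RootLabeled Ls →
    ∀ k → 2 * k ≤ m → bCoeffAt Ls α i k ≡ rhsAt (suc m) α i k
  bCoeffAt≡rhsAt m (_ , sumα≡1+m) Ls rootLabeled k 2k≤m = begin
    ΣFin (suc m) (λ r → countFuns (suc m) (length α) (counted? α i (Ls r) k))
      ≡⟨ sumMap-cong (allFin (suc m)) perRoot ⟩
    ΣFin (suc m) (λ r → M * markings (m ∸ toℕ r) (toℕ r) H L k)
      ≡⟨ *-distribˡ-sumMap (allFin (suc m)) M (λ r → markings (m ∸ toℕ r) (toℕ r) H L k) ⟩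
    M * ΣFin (suc m) (λ r → markings (m ∸ toℕ r) (toℕ r) H L k)
      ≡⟨ cong (M *_) (ΣFin-toℕ (suc m) (λ r → markings (m ∸ r) r H L k)) ⟩
    M * sumBelow (suc m) (λ r → markings (m ∸ r) r H L k)
      ≡⟨ cong (M *_) (sumBelow-markings-min m H L k (H+L≡m m sumα≡1+m) 2k≤m) ⟩
    M * sumBelow (suc ((H ⊓ L) ⊓ k)) (rootSumTerm m (H ⊓ L) k)
      ≡⟨ rhsAt≡ m k ⟨
    rhsAt (suc m) α i k ∎
    where
    open ≡-Reasoning
    M : ℕ
    M = highMultinomial leafContent * lowMultinomial leafContent
    perRoot : ∀ r → countFuns (suc m) (length α) (counted? α i (Ls r) k) ≡ M * markings (m ∸ toℕ r) (toℕ r) H L k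
    perRoot r = begin
      countFuns (suc m) (length α) (counted? α i (Ls r) k)
        ≡⟨ countedColorings≡leafColorings (Ls r) k ⟩
      leafColorings m (aboveRoot (Ls r)) leafContent k
        ≡⟨ leafColorings≡leafFormula m (aboveRoot (Ls r)) leafContent k leafContent-i ⟩
      leafFormula (aboveRoot (Ls r)) leafContent k
        ≡⟨ cong₂ (λ a b → M * markings a b H L k)
                 (trans (aboveCount-aboveRoot (Ls r)) (cong (λ x → m ∸ toℕ x) (rootLabeled r)))
                 (trans (belowCount-aboveRoot (Ls r)) (cong toℕ (rootLabeled r))) ⟩
      M * markings (m ∸ toℕ r) (toℕ r) H L k ∎
      where open Labeling

theorem4p10 : (m : ℕ) → 1 ≤ m → (α : List ℕ) → IsComposition (suc m) α
    → (Ls : Fin (suc m) → Permutation′ (suc m)) → RootLabeled Ls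
    → (k : ℕ) → 2 * k ≤ m
    → (bCoeff Ls α k ≡ rhs (suc m) α k)
      × ((i : Fin (length α)) → lookup α i ≡ 1 → bCoeffAt Ls α i k ≡ rhsAt (suc m) α i k)
theorem4p10 m _ α composition Ls rootLabeled k 2k≤m = bCoeff≡rhs , bCoeffAt≡rhsAt′
  where
  bCoeffAt≡rhsAt′ : (i : Fin (length α)) → lookup α i ≡ 1 → bCoeffAt Ls α i k ≡ rhsAt (suc m) α i k
  bCoeffAt≡rhsAt′ i αᵢ≡1 = RootColor.bCoeffAt≡rhsAt α i αᵢ≡1 m composition Ls rootLabeled k 2k≤m
  -- The summands of bCoeff and rhs are anonymous with-functions of Defs, so this type is left to
  -- unification; it is solved by the use in bCoeff≡rhs, which is therefore checked first.
  summand≡ : (i : Fin (length α)) → _ ≡ _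
  bCoeff≡rhs : bCoeff Ls α k ≡ rhs (suc m) α k
  bCoeff≡rhs = sumMap-cong (allFin (length α)) summand≡
  summand≡ i with lookup α i ≟ 1
  ... | yes αᵢ≡1 = bCoeffAt≡rhsAt′ i αᵢ≡1
  ... | no  _    = refl
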